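{- Let $k\ge2$ and let $\widetilde{\Pi}^{(k)}$ be the set of open partition diagrams containing neither an enhanced $(k+1)$-nesting nor a future enhanced $(k+1)$-nesting. To each diagram $\pi$ associate the label $\ell(\pi)=[s_0,\dots,s_{k-1}]$, where $s_i$ is the number of semi-arcs of $\pi$ with enhanced nesting index $\ge i$. Consider the generating tree with root label $[0,0,\dots,0]$ and succession rule sending $[s_0,s_1,\dots,s_{k-1}]$ to the following labels: (1) $[s_0,s_0,s_2,\dots,s_{k-1}]$; (2) $[s_0+1,s_1,\dots,s_{k-1}]$; (3) $[s_0,s_1-1,\dots,s_{j-1}-1,i,s_{j+1},\dots,s_{k-1}]$ for each $1\le j\le k-1$ and each $i$ with $s_j\le i\le s_{j-1}-1$; (4) $[s_0-1,s_1-1,\dots,s_{j-1}-1,i,s_{j+1},\dots,s_{k-1}]$ for each $1\le j\le k-1$ and each $i$ with $s_j\le i\le s_{j-1}-1$; (5) $[s_0,s_1-1,\dots,s_{k-1}-1]$ and $[s_0-1,s_1-1,\dots,s_{k-1}-1]$, if $s_{k-1}>0$. Then for every $n\ge0$ the number of diagrams in $\widetilde{\Pi}^{(k)}$ of size $n$ equals the number of nodes at level $n$ of this generating tree.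
   Context: An open partition diagram of size $n\ge 0$ consists of vertices $1,\dots,n$ in a row, a set of arcs $(a,b)$ with $1\le a<b\le n$ and a set of semi-arcs $(a,*)$ with $1\le a\le n$ (a semi-arc has a left end-point but no right end-point), such that every vertex is the left end-point of at most one arc or semi-arc and the right end-point of at most one arc. (Equivalently: a set partition of $\{1,\dots,n\}$ with each block marked closed or open; block $\{a_1<\dots<a_r\}$ gives arcs $(a_1,a_2),\dots,(a_{r-1},a_r)$ and, if open, the semi-arc $(a_r,*)$.) A fixed point is a vertex incident to no arc and no semi-arc. A $k$-nesting is a set of $k$ arcs $(i_1,j_1),\dots,(i_k,j_k)$ with $i_1<\dots<i_k<j_k<\dots<j_1$. An enhanced $k$-nesting is either a $k$-nesting, or a set of $k-1$ arcs $(i_1,j_1),\dots,(i_{k-1},j_{k-1})$ together with a fixed point $i_k$ such that $i_1<\dots<i_{k-1}<i_k<j_{k-1}<\dots<j_1$. A future enhanced $k$-nesting is an enhanced $(k-1)$-nesting together with a semi-arc whose left end-point is smaller than all vertices involved in that enhanced $(k-1)$-nesting. The enhanced nesting index of a semi-arc is the largest $j\ge0$ such that the semi-arc belongs to a future enhanced $(j+1)$-nesting ($0$ if none). A generating tree with root label $L_0$ and a succession rule (assigning to each label a finite list of labels, with multiplicity) is the rooted tree whose root, at level $0$, has label $L_0$, and in which each node with label $L$ has one child for each entry of the list assigned to $L$, labelled by that entry; level $n$ consists of the nodes at distance $n$ from the root. -}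

module Defs where

open import Data.Nat using (ℕ; zero; suc; _+_; _∸_; _<ᵇ_; _≡ᵇ_; _≤ᵇ_)
open import Data.Bool using (Bool; true; false; if_then_else_; _∧_)
open import Data.Fin using (Fin) renaming (_<_ to _<ᶠ_)
open import Data.Vec using (Vec; lookup)
open import Data.List using (List; []; _∷_; map; _++_; reverse; length; upTo; concat; replicate)
open import Data.Nat.ListAction using (sum)
open import Data.List.Relation.Unary.All using (All)
open import Data.List.Relation.Unary.Linked using (Linked)
open import Data.Product using (Σ; _×_; _,_; proj₁; proj₂)
open import Data.Empty using (⊥)
open import Relation.Binary.PropositionalEquality using (_≡_; _≢_)
open import Relation.Nullary using (¬_)

-- Vertices are Fin n (vertex t stands for t+1).  For each vertex a,
-- `out` records what a is the LEFT end-point of: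
--   none      : nothing
--   semi      : a semi-arc (a,*)
--   arc b     : an arc (a,b)
-- so each vertex is the left end-point of at most one arc or semi-arc.

data Out (n : ℕ) : Set where
  none : Out n
  semi : Out n
  arc  : Fin n → Out n

record WellFormed {n : ℕ} (out : Vec (Out n) n) : Set where
  field
    leftLess  : ∀ a b → lookup out a ≡ arc b → a <ᶠ b
    rightOnce : ∀ a a' b → lookup out a ≡ arc b → lookup out a' ≡ arc b → a ≡ a'

record Diagram (n : ℕ) : Set where
  constructor diagram
  field
    out : Vec (Out n) n
    .wf : WellFormed out

open Diagram public

module _ {n : ℕ} (π : Diagram n) where

  IsArc : Fin n × Fin n → Set
  IsArc (a , b) = lookup (out π) a ≡ arc b

  IsSemi : Fin n → Set
  IsSemi a = lookup (out π) a ≡ semi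

  IsFixed : Fin n → Set
  IsFixed v = lookup (out π) v ≡ none × (∀ a → lookup (out π) a ≢ arc v)

  Increasing : List (Fin n) → Set
  Increasing = Linked _<ᶠ_

  -- Enhanced m-nesting.  For arcs (i₁,j₁),…,(iₘ,jₘ) given as the list ps,
  -- the condition i₁<…<iₘ<jₘ<…<j₁ is that the list
  -- i₁,…,iₘ,jₘ,…,j₁ is strictly increasing.
  data EnhancedNesting (m : ℕ) : Set where
    nesting  : (ps : List (Fin n × Fin n)) → length ps ≡ m → All IsArc ps →
               Increasing (map proj₁ ps ++ reverse (map proj₂ ps)) →
               EnhancedNesting m
    enhanced : (ps : List (Fin n × Fin n)) (f : Fin n) → suc (length ps) ≡ m →
               All IsArc ps → IsFixed f →
               Increasing (map proj₁ ps ++ f ∷ reverse (map proj₂ ps)) →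
               EnhancedNesting m

  vertices : ∀ {m} → EnhancedNesting m → List (Fin n)
  vertices (nesting ps _ _ _)      = map proj₁ ps ++ reverse (map proj₂ ps)
  vertices (enhanced ps f _ _ _ _) = map proj₁ ps ++ f ∷ reverse (map proj₂ ps)

  FutureEnhancedNesting : ℕ → Set
  FutureEnhancedNesting zero    = ⊥
  FutureEnhancedNesting (suc m) =
    Σ (EnhancedNesting m) λ e → Σ (Fin n) λ s → IsSemi s × All (s <ᶠ_) (vertices e)

InPiTilde : (k : ℕ) {n : ℕ} → Diagram n → Set
InPiTilde k π = ¬ EnhancedNesting π (suc k) × ¬ FutureEnhancedNesting π (suc k)

-- s_t (0 for out-of-range t, never used)
get : List ℕ → ℕ → ℕ
get []       _       = 0
get (x ∷ _)  zero    = x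
get (_ ∷ xs) (suc t) = get xs t

mk : ℕ → (ℕ → ℕ) → List ℕ
mk k f = map f (upTo k)

module Rules (k : ℕ) (L : List ℕ) where
  s : ℕ → ℕ
  s = get L

  rule1 : List ℕ
  rule1 = mk k λ t → if t ≡ᵇ 1 then s 0 else s t

  rule2 : List ℕ
  rule2 = mk k λ t → if t ≡ᵇ 0 then suc (s 0) else s t

  rule3 : ℕ → ℕ → List ℕ
  rule3 j i = mk k λ t →
    if t ≡ᵇ j then i
    else if (1 ≤ᵇ t) ∧ (t <ᵇ j) then s t ∸ 1
    else s t

  rule4 : ℕ → ℕ → List ℕ
  rule4 j i = mk k λ t →
    if t ≡ᵇ j then i
    else if t <ᵇ j then s t ∸ 1
    else s t

  rule5a : List ℕ
  rule5a = mk k λ t → if t ≡ᵇ 0 then s 0 else s t ∸ 1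

  rule5b : List ℕ
  rule5b = mk k λ t → s t ∸ 1

  range : ℕ → List ℕ
  range j = map (s j +_) (upTo (s (j ∸ 1) ∸ s j))

  js : List ℕ
  js = map suc (upTo (k ∸ 1))

  children : List (List ℕ)
  children =
    rule1 ∷ rule2 ∷
    (concat (map (λ j → concat (map (λ i → rule3 j i ∷ rule4 j i ∷ []) (range j))) js)
    ++ (if 0 <ᵇ s (k ∸ 1) then rule5a ∷ rule5b ∷ [] else []))

open Rules using (children)

nodesAtLevel : (k : ℕ) → ℕ → List ℕ → ℕ
nodesAtLevel k zero    L = 1
nodesAtLevel k (suc n) L = sum (map (nodesAtLevel k n) (children k L))

rootLabel : ℕ → List ℕ
rootLabel k = replicate k 0

-- Record for every semi-arc its enhanced nesting index; listed from left to right these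
-- indices form a weakly decreasing "profile" whose counts s_t = #{entries ≥ t} are the label
-- [s₀, …, s_{k-1}].  The index of a semi-arc (s,*) is the size of the largest enhanced
-- nesting strictly right of s, so π ∈ Π̃⁽ᵏ⁾ exactly when that size is at most k for the
-- whole diagram and below k for every semi-arc.  A diagram of size n + 1 is a diagram of
-- size n plus a last vertex that is a fixed point, opens a semi-arc, or closes one of the
-- semi-arcs (possibly opening a new one).  Adding the vertex changes the profile locally
-- (entries left of the closed semi-arc are raised to its index + 1, the closed one is
-- removed, a new semi-arc contributes index 0), and the admissible additions correspond,
-- label for label, to the children in the succession rule.  Hence the diagrams of size n
-- are in label-preserving bijection with the nodes at level n.
module Submission where

open import Defs
open import Data.Nat using (ℕ; _≤_)
open import Data.Fin using (Fin)
open import Data.Product using (Σ)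
open import Data.Irrelevant using (Irrelevant)
open import Function.Bundles using (_↔_)

module Enumeration where

  open import Data.Nat using (ℕ; zero; suc)
  open import Data.Fin using (Fin; zero; suc; toℕ)
  open import Data.List using (List; []; _∷_; map; _++_; length; concat; lookup; applyUpTo)
  open import Data.Product using (Σ; _×_; _,_; proj₁; proj₂)
  open import Data.Sum using (_⊎_; inj₁; inj₂; [_,_]′)
  open import Data.Unit using (⊤; tt)
  open import Data.Empty using (⊥)
  open import Data.Bool using (Bool; true; false; if_then_else_; T)
  open import Relation.Binary.PropositionalEquality
  open import Axiom.UniquenessOfIdentityProofs.WithK using (uip)
  open import Function.Bundles using (_↔_; mk↔ₛ′)

  record Enum {A X : Set} (ℓ : A → X) (xs : List X) : Set where
    field
      to      : A → Fin (length xs)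
      from    : Fin (length xs) → A
      from-to : ∀ a → from (to a) ≡ a
      to-from : ∀ i → to (from i) ≡ i
      compat  : ∀ i → ℓ (from i) ≡ lookup xs i
  open Enum public

  module _ {X : Set} where

    enum-subst : {A : Set} {ℓ : A → X} {xs ys : List X} → xs ≡ ys → Enum ℓ xs → Enum ℓ ys
    enum-subst refl e = e

    enum-relabel : {A : Set} {ℓ ℓ′ : A → X} {xs : List X} → (∀ a → ℓ a ≡ ℓ′ a) → Enum ℓ xs → Enum ℓ′ xs
    enum-relabel eq e = record
      { to = to e ; from = from e ; from-to = from-to e ; to-from = to-from e
      ; compat = λ i → trans (sym (eq (from e i))) (compat e i) }

    enum-transport : {A A′ : Set} {ℓ : A → X} {xs : List X} (g : A′ → A) (h : A → A′) →
                     (∀ a → g (h a) ≡ a) → (∀ a′ → h (g a′) ≡ a′) → Enum ℓ xs → Enum (λ a′ → ℓ (g a′)) xs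
    enum-transport {ℓ = ℓ} g h gh hg e = record
      { to = λ a′ → to e (g a′)
      ; from = λ i → h (from e i)
      ; from-to = λ a′ → trans (cong h (from-to e (g a′))) (hg a′)
      ; to-from = λ i → trans (cong (to e) (gh (from e i))) (to-from e i)
      ; compat = λ i → trans (cong ℓ (gh (from e i))) (compat e i) }

    enum-[] : {A : Set} {ℓ : A → X} → (A → ⊥) → Enum ℓ []
    enum-[] ¬a = record { to = λ a → ⊥-elim′ (¬a a) ; from = λ () ; from-to = λ a → ⊥-elim′ (¬a a)
                        ; to-from = λ () ; compat = λ () }
      where ⊥-elim′ : {B : Set} → ⊥ → B
            ⊥-elim′ ()

    enum-[_] : (x : X) → Enum {A = ⊤} (λ _ → x) (x ∷ [])
    enum-[ x ] = record { to = λ _ → zero ; from = λ _ → tt ; from-to = λ _ → refl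
                        ; to-from = λ { zero → refl } ; compat = λ { zero → refl } }

    enum-Bool : (x y : X) → Enum {A = Bool} (λ b → if b then x else y) (x ∷ y ∷ [])
    enum-Bool x y = record
      { to = λ { true → zero ; false → suc zero }
      ; from = λ { zero → true ; (suc zero) → false }
      ; from-to = λ { true → refl ; false → refl }
      ; to-from = λ { zero → refl ; (suc zero) → refl }
      ; compat = λ { zero → refl ; (suc zero) → refl } }

    enum-if : (b : Bool) (x y : X) →
              Enum {A = T b × Bool} (λ p → if proj₂ p then x else y) (if b then x ∷ y ∷ [] else [])
    enum-if true x y = enum-transport proj₂ (tt ,_) (λ _ → refl) (λ { (tt , _) → refl }) (enum-Bool x y)
    enum-if false x y = enum-[] (λ ())

    splitIndex : ∀ (xs ys : List X) → Fin (length (xs ++ ys)) → Fin (length xs) ⊎ Fin (length ys)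
    splitIndex []       ys i       = inj₂ i
    splitIndex (x ∷ xs) ys zero    = inj₁ zero
    splitIndex (x ∷ xs) ys (suc i) with splitIndex xs ys i
    ... | inj₁ j = inj₁ (suc j)
    ... | inj₂ j = inj₂ j

    joinIndex : ∀ (xs ys : List X) → Fin (length xs) ⊎ Fin (length ys) → Fin (length (xs ++ ys))
    joinIndex []       ys (inj₂ j)       = j
    joinIndex (x ∷ xs) ys (inj₁ zero)    = zero
    joinIndex (x ∷ xs) ys (inj₁ (suc j)) = suc (joinIndex xs ys (inj₁ j))
    joinIndex (x ∷ xs) ys (inj₂ j)       = suc (joinIndex xs ys (inj₂ j))

    splitIndex-joinIndex : ∀ xs ys s → splitIndex xs ys (joinIndex xs ys s) ≡ s
    splitIndex-joinIndex []       ys (inj₂ j)       = refl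
    splitIndex-joinIndex (x ∷ xs) ys (inj₁ zero)    = refl
    splitIndex-joinIndex (x ∷ xs) ys (inj₁ (suc j)) rewrite splitIndex-joinIndex xs ys (inj₁ j) = refl
    splitIndex-joinIndex (x ∷ xs) ys (inj₂ j)       rewrite splitIndex-joinIndex xs ys (inj₂ j) = refl

    joinIndex-splitIndex : ∀ xs ys i → joinIndex xs ys (splitIndex xs ys i) ≡ i
    joinIndex-splitIndex []       ys i       = refl
    joinIndex-splitIndex (x ∷ xs) ys zero    = refl
    joinIndex-splitIndex (x ∷ xs) ys (suc i) with splitIndex xs ys i | joinIndex-splitIndex xs ys i
    ... | inj₁ j | eq = cong suc eq
    ... | inj₂ j | eq = cong suc eq

    lookup-joinIndex₁ : ∀ xs ys j → lookup (xs ++ ys) (joinIndex xs ys (inj₁ j)) ≡ lookup xs j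
    lookup-joinIndex₁ (x ∷ xs) ys zero    = refl
    lookup-joinIndex₁ (x ∷ xs) ys (suc j) = lookup-joinIndex₁ xs ys j

    lookup-joinIndex₂ : ∀ xs ys j → lookup (xs ++ ys) (joinIndex xs ys (inj₂ j)) ≡ lookup ys j
    lookup-joinIndex₂ []       ys j = refl
    lookup-joinIndex₂ (x ∷ xs) ys j = lookup-joinIndex₂ xs ys j

    enum-++ : {A B : Set} {ℓ₁ : A → X} {ℓ₂ : B → X} {xs ys : List X} →
              Enum ℓ₁ xs → Enum ℓ₂ ys → Enum {A = A ⊎ B} [ ℓ₁ , ℓ₂ ]′ (xs ++ ys)
    enum-++ {A} {B} {ℓ₁} {ℓ₂} {xs} {ys} e₁ e₂ = record
      { to = to′
      ; from = λ i → fromSplit (splitIndex xs ys i)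
      ; from-to = λ { (inj₁ a) → trans (cong fromSplit (splitIndex-joinIndex xs ys (inj₁ (to e₁ a)))) (cong inj₁ (from-to e₁ a))
                    ; (inj₂ b) → trans (cong fromSplit (splitIndex-joinIndex xs ys (inj₂ (to e₂ b)))) (cong inj₂ (from-to e₂ b)) }
      ; to-from = to-from′
      ; compat = compat′ }
      where
      fromSplit : Fin (length xs) ⊎ Fin (length ys) → A ⊎ B
      fromSplit (inj₁ j) = inj₁ (from e₁ j)
      fromSplit (inj₂ j) = inj₂ (from e₂ j)
      to′ : A ⊎ B → Fin (length (xs ++ ys))
      to′ (inj₁ a) = joinIndex xs ys (inj₁ (to e₁ a))
      to′ (inj₂ b) = joinIndex xs ys (inj₂ (to e₂ b))
      to-from′ : ∀ i → to′ (fromSplit (splitIndex xs ys i)) ≡ i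
      to-from′ i with splitIndex xs ys i | joinIndex-splitIndex xs ys i
      ... | inj₁ j | eq = trans (cong (λ z → joinIndex xs ys (inj₁ z)) (to-from e₁ j)) eq
      ... | inj₂ j | eq = trans (cong (λ z → joinIndex xs ys (inj₂ z)) (to-from e₂ j)) eq
      compat′ : ∀ i → [ ℓ₁ , ℓ₂ ]′ (fromSplit (splitIndex xs ys i)) ≡ lookup (xs ++ ys) i
      compat′ i with splitIndex xs ys i | joinIndex-splitIndex xs ys i
      ... | inj₁ j | eq = trans (compat e₁ j) (trans (sym (lookup-joinIndex₁ xs ys j)) (cong (lookup (xs ++ ys)) eq))
      ... | inj₂ j | eq = trans (compat e₂ j) (trans (sym (lookup-joinIndex₂ xs ys j)) (cong (lookup (xs ++ ys)) eq))

    enum-∷ : {B : Set} {ℓ : B → X} {x : X} {ys : List X} → Enum ℓ ys →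
             Enum {A = ⊤ ⊎ B} [ (λ _ → x) , ℓ ]′ (x ∷ ys)
    enum-∷ {x = x} e = enum-++ enum-[ x ] e

    enum-ΣFin : {Y : Set} (xs : List Y) (f : Y → List X) {C : Fin (length xs) → Set}
                {ℓ : ∀ i → C i → X} → (∀ i → Enum (ℓ i) (f (lookup xs i))) →
                Enum {A = Σ (Fin (length xs)) C} (λ p → ℓ (proj₁ p) (proj₂ p)) (concat (map f xs))
    enum-ΣFin []       f E = enum-[] (λ { (() , _) })
    enum-ΣFin (x ∷ xs) f {C} E =
      enum-relabel (λ { (zero , c) → refl ; (suc i , c) → refl })
        (enum-transport g h gh hg (enum-++ (E zero) (enum-ΣFin xs f (λ i → E (suc i)))))
      where
      g : Σ (Fin (suc (length xs))) C → C zero ⊎ Σ (Fin (length xs)) (λ i → C (suc i))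
      g (zero , c)  = inj₁ c
      g (suc i , c) = inj₂ (i , c)
      h : C zero ⊎ Σ (Fin (length xs)) (λ i → C (suc i)) → Σ (Fin (suc (length xs))) C
      h (inj₁ c)       = zero , c
      h (inj₂ (i , c)) = suc i , c
      gh : ∀ a → g (h a) ≡ a
      gh (inj₁ c)       = refl
      gh (inj₂ (i , c)) = refl
      hg : ∀ a → h (g a) ≡ a
      hg (zero , c)  = refl
      hg (suc i , c) = refl

    Σ-≡-subst : {A : Set} (B : A → Set) {a a′ : A} (p : a′ ≡ a) (b : B a) →
                _≡_ {A = Σ A B} (a′ , subst B (sym p) b) (a , b)
    Σ-≡-subst B refl b = refl

    Σ-≡-reindex : {A I : Set} (B : A → Set) (f : I → A) {i j : I} (p : j ≡ i) (q : f i ≡ f j) (b : B (f i)) →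
                  _≡_ {A = Σ I (λ i → B (f i))} (j , subst B q b) (i , b)
    Σ-≡-reindex B f refl q b rewrite uip q refl = refl

    enum-Σ : {A Y : Set} {B : A → Set} {ℓ : A → Y} {ys : List Y} (f : Y → List X)
             {ℓB : ∀ a → B a → X} → Enum ℓ ys → (∀ a → Enum (ℓB a) (f (ℓ a))) →
             Enum {A = Σ A B} (λ p → ℓB (proj₁ p) (proj₂ p)) (concat (map f ys))
    enum-Σ {A} {Y} {B} {ℓ} {ys} f {ℓB} eA eB =
      enum-relabel (λ p → cong (λ q → ℓB (proj₁ q) (proj₂ q)) (hg p))
        (enum-transport g h gh hg (enum-ΣFin ys f (λ i → enum-subst (cong f (compat eA i)) (eB (from eA i)))))
      where
      g : Σ A B → Σ (Fin (length ys)) (λ i → B (from eA i))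
      g (a , b) = to eA a , subst B (sym (from-to eA a)) b
      h : Σ (Fin (length ys)) (λ i → B (from eA i)) → Σ A B
      h (i , b) = from eA i , b
      gh : ∀ p → g (h p) ≡ p
      gh (i , b) = Σ-≡-reindex B (from eA) (to-from eA i) (sym (from-to eA (from eA i))) b
      hg : ∀ p → h (g p) ≡ p
      hg (a , b) = Σ-≡-subst B (from-to eA a) b

    enum-applyUpTo : (m : ℕ) (g : ℕ → X) → Enum {A = Fin m} (λ b → g (toℕ b)) (applyUpTo g m)
    enum-applyUpTo zero    g = enum-[] (λ ())
    enum-applyUpTo (suc m) g =
      enum-relabel (λ { zero → refl ; (suc b) → refl })
        (enum-transport split join split-join join-split (enum-∷ (enum-applyUpTo m (λ t → g (suc t)))))
      where
      split : Fin (suc m) → ⊤ ⊎ Fin m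
      split zero    = inj₁ tt
      split (suc b) = inj₂ b
      join : ⊤ ⊎ Fin m → Fin (suc m)
      join (inj₁ _) = zero
      join (inj₂ b) = suc b
      split-join : ∀ a → split (join a) ≡ a
      split-join (inj₁ tt) = refl
      split-join (inj₂ b)  = refl
      join-split : ∀ a → join (split a) ≡ a
      join-split zero    = refl
      join-split (suc b) = refl

  enum⇒↔ : {A X : Set} {ℓ : A → X} {xs : List X} → Enum ℓ xs → A ↔ Fin (length xs)
  enum⇒↔ e = mk↔ₛ′ (to e) (from e) (to-from e) (from-to e)

module TreeLevels (k : ℕ) where

  open import Data.Nat using (ℕ; zero; suc; _+_)
  open import Data.Nat.Properties using (+-identityʳ)
  open import Data.List using (List; []; _∷_; map; _++_; length; concat)
  open import Data.List.Properties using (map-++)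
  open import Data.Nat.ListAction using (sum)
  open import Data.Nat.ListAction.Properties using (sum-++)
  open import Relation.Binary.PropositionalEquality
  open Rules k using (children)

  descendants : ℕ → List (List ℕ) → List (List ℕ)
  descendants zero    Ls = Ls
  descendants (suc n) Ls = descendants n (concat (map children Ls))

  level : ℕ → List (List ℕ)
  level n = descendants n (rootLabel k ∷ [])

  sum-map-concat-children : (g : List ℕ → ℕ) (Ls : List (List ℕ)) →
    sum (map g (concat (map children Ls))) ≡ sum (map (λ L → sum (map g (children L))) Ls)
  sum-map-concat-children g []       = refl
  sum-map-concat-children g (L ∷ Ls) = begin
      sum (map g (children L ++ concat (map children Ls)))
    ≡⟨ cong sum (map-++ g (children L) _) ⟩
      sum (map g (children L) ++ map g (concat (map children Ls)))
    ≡⟨ sum-++ (map g (children L)) _ ⟩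
      sum (map g (children L)) + sum (map g (concat (map children Ls)))
    ≡⟨ cong (sum (map g (children L)) +_) (sum-map-concat-children g Ls) ⟩
      sum (map g (children L)) + sum (map (λ L → sum (map g (children L))) Ls) ∎
    where open ≡-Reasoning

  sum-nodesAtLevel : ∀ n Ls → sum (map (nodesAtLevel k n) Ls) ≡ length (descendants n Ls)
  sum-nodesAtLevel zero    []       = refl
  sum-nodesAtLevel zero    (L ∷ Ls) = cong suc (sum-nodesAtLevel zero Ls)
  sum-nodesAtLevel (suc n) Ls =
    trans (sym (sum-map-concat-children (nodesAtLevel k n) Ls)) (sum-nodesAtLevel n (concat (map children Ls)))

  descendants-suc : ∀ n Ls → descendants (suc n) Ls ≡ concat (map children (descendants n Ls))
  descendants-suc zero    Ls = refl
  descendants-suc (suc n) Ls = descendants-suc n (concat (map children Ls))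

  nodesAtLevel≡length-level : ∀ n → nodesAtLevel k n (rootLabel k) ≡ length (level n)
  nodesAtLevel≡length-level n = trans (sym (+-identityʳ _)) (sum-nodesAtLevel n (rootLabel k ∷ []))


module BoolFacts where

  open import Data.Bool using (true; false; T)
  open import Data.Bool.Properties using (T-≡)
  open import Data.Nat using (_≤_; _<_; _≤ᵇ_; _<ᵇ_; _≡ᵇ_)
  open import Data.Nat.Properties using (≤⇒≤ᵇ; ≤ᵇ⇒≤; <⇒<ᵇ; <ᵇ⇒<; ≡⇒≡ᵇ; ≡ᵇ⇒≡)
  open import Data.Empty using (⊥-elim)
  open import Function.Bundles using (Equivalence)
  open import Relation.Nullary using (¬_)
  open import Relation.Binary.PropositionalEquality using (_≡_; _≢_; refl)

  T⇒≡true : ∀ {b} → T b → b ≡ true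
  T⇒≡true = Equivalence.to T-≡

  ≡true⇒T : ∀ {b} → b ≡ true → T b
  ≡true⇒T = Equivalence.from T-≡

  ¬T⇒≡false : ∀ {b} → ¬ T b → b ≡ false
  ¬T⇒≡false {false} _  = refl
  ¬T⇒≡false {true}  ¬t = ⊥-elim (¬t _)

  ≤ᵇ-true : ∀ {m n} → m ≤ n → (m ≤ᵇ n) ≡ true
  ≤ᵇ-true m≤n = T⇒≡true (≤⇒≤ᵇ m≤n)

  ≤ᵇ-false : ∀ {m n} → ¬ m ≤ n → (m ≤ᵇ n) ≡ false
  ≤ᵇ-false {m} {n} m≰n = ¬T⇒≡false (λ t → m≰n (≤ᵇ⇒≤ m n t))

  <ᵇ-true : ∀ {m n} → m < n → (m <ᵇ n) ≡ true
  <ᵇ-true m<n = T⇒≡true (<⇒<ᵇ m<n)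

  <ᵇ-false : ∀ {m n} → ¬ m < n → (m <ᵇ n) ≡ false
  <ᵇ-false {m} {n} m≮n = ¬T⇒≡false (λ t → m≮n (<ᵇ⇒< m n t))

  ≡ᵇ-true : ∀ n → (n ≡ᵇ n) ≡ true
  ≡ᵇ-true n = T⇒≡true (≡⇒≡ᵇ n n refl)

  ≡ᵇ-false : ∀ {m n} → m ≢ n → (m ≡ᵇ n) ≡ false
  ≡ᵇ-false {m} {n} m≢n = ¬T⇒≡false (λ t → m≢n (≡ᵇ⇒≡ m n t))

module Profiles where

  open import Data.Nat using (ℕ; zero; suc; _+_; _∸_; _≤_; _<_; _≥_; _⊔_; _≤ᵇ_; _<ᵇ_; _≡ᵇ_; z≤n; s≤s)
  open import Data.Nat.Properties
  open import Data.Fin using (Fin; zero; suc; toℕ; fromℕ<)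
  open import Data.Fin.Properties using (toℕ-fromℕ<; toℕ-injective; toℕ<n)
  open import Data.List using (List; []; _∷_; map; _++_; length; lookup; concat; applyUpTo; replicate; take; drop)
  open import Data.List.Properties using (map-upTo; map-cong-local)
  open import Data.List.Membership.Propositional.Properties using (∈-lookup)
  open import Data.List.Relation.Unary.All as All using (All; []; _∷_)
  open import Data.List.Relation.Unary.All.Properties using (++⁺; ++⁻ˡ; gmap⁺; gmap⁻)
  open import Data.List.Relation.Unary.AllPairs using (AllPairs; []; _∷_)
  open import Data.Product using (Σ; _×_; _,_)
  open import Data.Sum using (_⊎_; inj₁; inj₂; [_,_]′)
  open import Data.Unit using (⊤; tt)
  open import Data.Empty using (⊥-elim)
  open import Data.Bool using (Bool; true; false; if_then_else_; T; _∧_; _∨_)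
  open import Data.Bool.Properties using (T-irrelevant; T-∨)
  open import Function using (id)
  open import Function.Bundles using (Equivalence)
  open import Relation.Nullary using (¬_; Dec; yes; no)
  open import Relation.Binary.Definitions using (tri<; tri≈; tri>)
  open import Relation.Binary.PropositionalEquality
  open Enumeration
  open BoolFacts

  All-lookup : ∀ {A : Set} {P : A → Set} {xs : List A} → All P xs → (r : Fin (length xs)) → P (lookup xs r)
  All-lookup a r = All.lookup a (∈-lookup r)

  atLeast : ℕ → List ℕ → ℕ
  atLeast t []       = 0
  atLeast t (x ∷ xs) = if t ≤ᵇ x then suc (atLeast t xs) else atLeast t xs

  atLeast-∷-≤ : ∀ {t x} xs → t ≤ x → atLeast t (x ∷ xs) ≡ suc (atLeast t xs)
  atLeast-∷-≤ xs t≤x rewrite ≤ᵇ-true t≤x = refl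

  atLeast-∷-> : ∀ {t x} xs → x < t → atLeast t (x ∷ xs) ≡ atLeast t xs
  atLeast-∷-> xs x<t rewrite ≤ᵇ-false (<⇒≱ x<t) = refl

  atLeast-0 : ∀ xs → atLeast 0 xs ≡ length xs
  atLeast-0 []       = refl
  atLeast-0 (x ∷ xs) = cong suc (atLeast-0 xs)

  atLeast-++ : ∀ t xs ys → atLeast t (xs ++ ys) ≡ atLeast t xs + atLeast t ys
  atLeast-++ t []       ys = refl
  atLeast-++ t (x ∷ xs) ys with t ≤ᵇ x
  ... | true  = cong suc (atLeast-++ t xs ys)
  ... | false = atLeast-++ t xs ys

  atLeast-all< : ∀ {t} xs → All (_< t) xs → atLeast t xs ≡ 0
  atLeast-all< []       []         = refl
  atLeast-all< (x ∷ xs) (x<t ∷ xs<t) = trans (atLeast-∷-> xs x<t) (atLeast-all< xs xs<t)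

  atLeast-antitone : ∀ xs {t t′} → t ≤ t′ → atLeast t′ xs ≤ atLeast t xs
  atLeast-antitone []       t≤t′ = z≤n
  atLeast-antitone (x ∷ xs) {t} {t′} t≤t′ with t′ ≤? x | t ≤? x
  ... | yes t′≤x | _ rewrite atLeast-∷-≤ xs t′≤x | atLeast-∷-≤ xs (≤-trans t≤t′ t′≤x) =
    s≤s (atLeast-antitone xs t≤t′)
  ... | no t′≰x | yes t≤x rewrite atLeast-∷-> xs (≰⇒> t′≰x) | atLeast-∷-≤ xs t≤x =
    m≤n⇒m≤1+n (atLeast-antitone xs t≤t′)
  ... | no t′≰x | no t≰x rewrite atLeast-∷-> xs (≰⇒> t′≰x) | atLeast-∷-> xs (≰⇒> t≰x) =
    atLeast-antitone xs t≤t′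

  atLeast≤length : ∀ t xs → atLeast t xs ≤ length xs
  atLeast≤length t xs = subst (atLeast t xs ≤_) (atLeast-0 xs) (atLeast-antitone xs z≤n)

  Decreasing : List ℕ → Set
  Decreasing = AllPairs _≥_

  ≤lookup⇒<atLeast : ∀ {t} ι → Decreasing ι → (r : Fin (length ι)) → t ≤ lookup ι r → toℕ r < atLeast t ι
  ≤lookup⇒<atLeast (x ∷ ι) (x≥ι ∷ dι) zero t≤x rewrite atLeast-∷-≤ ι t≤x = s≤s z≤n
  ≤lookup⇒<atLeast (x ∷ ι) (x≥ι ∷ dι) (suc r) t≤ιr
    rewrite atLeast-∷-≤ ι (≤-trans t≤ιr (All-lookup x≥ι r)) = s≤s (≤lookup⇒<atLeast ι dι r t≤ιr)

  <atLeast⇒≤lookup : ∀ {t} ι → Decreasing ι → (r : Fin (length ι)) → toℕ r < atLeast t ι → t ≤ lookup ι r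
  <atLeast⇒≤lookup {t} (x ∷ ι) (x≥ι ∷ dι) r r< with t ≤? x
  <atLeast⇒≤lookup {t} (x ∷ ι) (x≥ι ∷ dι) zero    r< | yes t≤x = t≤x
  <atLeast⇒≤lookup {t} (x ∷ ι) (x≥ι ∷ dι) (suc r) r< | yes t≤x =
    <atLeast⇒≤lookup ι dι r (≤-pred (subst (suc (toℕ r) <_) (atLeast-∷-≤ ι t≤x) r<))
  ... | no t≰x = ⊥-elim (n≮0 (subst (toℕ r <_) (atLeast-all< (x ∷ ι) (x<t ∷ All.map (λ y≤x → ≤-<-trans y≤x x<t) x≥ι)) r<))
    where x<t : x < t
          x<t = ≰⇒> t≰x

  zeroIf : Bool → List ℕ
  zeroIf true  = 0 ∷ []
  zeroIf false = []

  addFixed : List ℕ → List ℕ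
  addFixed ι = map (_⊔ 1) ι

  addSemi : List ℕ → List ℕ
  addSemi ι = ι ++ 0 ∷ []

  closeWith : ℕ → List ℕ → ℕ → Bool → List ℕ
  closeWith d []      r       o = zeroIf o
  closeWith d (x ∷ ι) zero    o = ι ++ zeroIf o
  closeWith d (x ∷ ι) (suc r) o = (x ⊔ suc d) ∷ closeWith d ι r o

  closeSemi : (ι : List ℕ) → Fin (length ι) → Bool → List ℕ
  closeSemi ι r o = closeWith (lookup ι r) ι (toℕ r) o

  closeWith-map : ∀ {A : Set} d (g f : A → ℕ) xs r o →
                  All (λ x → f x ≡ g x ⊔ suc d) (take r xs) → All (λ x → f x ≡ g x) (drop (suc r) xs) →
                  closeWith d (map g xs) r o ≡ map f (take r xs ++ drop (suc r) xs) ++ zeroIf o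
  closeWith-map d g f []       zero    o _           _   = refl
  closeWith-map d g f []       (suc r) o _           _   = refl
  closeWith-map d g f (x ∷ xs) zero    o _           f≡g = cong (_++ zeroIf o) (sym (map-cong-local f≡g))
  closeWith-map d g f (x ∷ xs) (suc r) o (fx≡ ∷ f≡) f≡g = cong₂ _∷_ (sym fx≡) (closeWith-map d g f xs r o f≡ f≡g)

  atLeast-zeroIf : ∀ t o → atLeast (suc t) (zeroIf o) ≡ 0
  atLeast-zeroIf t true  = refl
  atLeast-zeroIf t false = refl

  atLeast-closeSemi-≤ : ∀ ι → Decreasing ι → (r : Fin (length ι)) (o : Bool) {t : ℕ} → t ≤ lookup ι r →
                        atLeast t (closeSemi ι r o) ≡ atLeast t ι ∸ 1 + atLeast t (zeroIf o)
  atLeast-closeSemi-≤ (x ∷ ι) (x≥ι ∷ dι) zero o {t} t≤x rewrite atLeast-∷-≤ ι t≤x = atLeast-++ t ι (zeroIf o)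
  atLeast-closeSemi-≤ (x ∷ ι) (x≥ι ∷ dι) (suc r) o {t} t≤ιr
    rewrite atLeast-∷-≤ (closeWith (lookup ι r) ι (toℕ r) o) (≤-trans t≤ιr (≤-trans (n≤1+n _) (m≤n⊔m x (suc (lookup ι r)))))
          | atLeast-∷-≤ ι (≤-trans t≤ιr (All-lookup x≥ι r))
          | atLeast-closeSemi-≤ ι dι r o t≤ιr
    = pred-suc (atLeast t ι) (≤lookup⇒<atLeast ι dι r t≤ιr)
    where
    pred-suc : ∀ c → toℕ r < c → suc (c ∸ 1 + atLeast t (zeroIf o)) ≡ suc c ∸ 1 + atLeast t (zeroIf o)
    pred-suc (suc c) _ = refl

  atLeast-closeSemi-≡ : ∀ ι → Decreasing ι → (r : Fin (length ι)) (o : Bool) →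
                        atLeast (suc (lookup ι r)) (closeSemi ι r o) ≡ toℕ r
  atLeast-closeSemi-≡ (x ∷ ι) (x≥ι ∷ dι) zero o =
    trans (atLeast-++ (suc x) ι (zeroIf o)) (cong₂ _+_ (atLeast-all< ι (All.map s≤s x≥ι)) (atLeast-zeroIf x o))
  atLeast-closeSemi-≡ (x ∷ ι) (x≥ι ∷ dι) (suc r) o
    rewrite atLeast-∷-≤ (closeWith (lookup ι r) ι (toℕ r) o) (m≤n⊔m x (suc (lookup ι r))) = cong suc (atLeast-closeSemi-≡ ι dι r o)

  atLeast-closeSemi-> : ∀ ι → Decreasing ι → (r : Fin (length ι)) (o : Bool) {t : ℕ} → suc (lookup ι r) < t →
                        atLeast t (closeSemi ι r o) ≡ atLeast t ι
  atLeast-closeSemi-> (x ∷ ι) (x≥ι ∷ dι) zero o {suc t} x+1<t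
    rewrite atLeast-∷-> ι (≤-trans (n≤1+n _) x+1<t) =
    trans (atLeast-++ (suc t) ι (zeroIf o)) (trans (cong (atLeast (suc t) ι +_) (atLeast-zeroIf t o)) (+-identityʳ _))
  atLeast-closeSemi-> (x ∷ ι) (x≥ι ∷ dι) (suc r) o {t} ιr+1<t with t ≤? x
  ... | yes t≤x rewrite atLeast-∷-≤ (closeWith (lookup ι r) ι (toℕ r) o) (≤-trans t≤x (m≤m⊔n x (suc (lookup ι r))))
                      | atLeast-∷-≤ ι t≤x
    = cong suc (atLeast-closeSemi-> ι dι r o ιr+1<t)
  ... | no t≰x rewrite atLeast-∷-> (closeWith (lookup ι r) ι (toℕ r) o) (⊔-lub (≰⇒> t≰x) ιr+1<t) | atLeast-∷-> ι (≰⇒> t≰x)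
    = atLeast-closeSemi-> ι dι r o ιr+1<t

  atLeast-addFixed-≤1 : ∀ ι {t} → t ≤ 1 → atLeast t (addFixed ι) ≡ length ι
  atLeast-addFixed-≤1 []      t≤1 = refl
  atLeast-addFixed-≤1 (x ∷ ι) t≤1 rewrite atLeast-∷-≤ (addFixed ι) (≤-trans t≤1 (m≤n⊔m x 1)) =
    cong suc (atLeast-addFixed-≤1 ι t≤1)

  atLeast-addFixed-≥2 : ∀ ι {t} → 2 ≤ t → atLeast t (addFixed ι) ≡ atLeast t ι
  atLeast-addFixed-≥2 []      2≤t = refl
  atLeast-addFixed-≥2 (x ∷ ι) {t} 2≤t with t ≤? x
  ... | yes t≤x rewrite atLeast-∷-≤ (addFixed ι) (≤-trans t≤x (m≤m⊔n x 1)) | atLeast-∷-≤ ι t≤x =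
    cong suc (atLeast-addFixed-≥2 ι 2≤t)
  ... | no t≰x rewrite atLeast-∷-> (addFixed ι) (⊔-lub (≰⇒> t≰x) 2≤t) | atLeast-∷-> ι (≰⇒> t≰x) =
    atLeast-addFixed-≥2 ι 2≤t

  All-zeroIf : ∀ {P : ℕ → Set} o → P 0 → All P (zeroIf o)
  All-zeroIf true  p = p ∷ []
  All-zeroIf false p = []

  All-closeWith : ∀ {Q : ℕ → Set} d ι r o → All Q ι → Q 0 → (∀ {y} → Q y → Q (y ⊔ suc d)) → All Q (closeWith d ι r o)
  All-closeWith d []      r       o []       q0 f = All-zeroIf o q0
  All-closeWith d (x ∷ ι) zero    o (p ∷ ps) q0 f = ++⁺ ps (All-zeroIf o q0)
  All-closeWith d (x ∷ ι) (suc r) o (p ∷ ps) q0 f = f p ∷ All-closeWith d ι r o ps q0 f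

  get-applyUpTo : ∀ k (h : ℕ → ℕ) (f : ℕ → ℕ) t → t < k → get (map f (applyUpTo h k)) t ≡ f (h t)
  get-applyUpTo (suc k) h f zero    _         = refl
  get-applyUpTo (suc k) h f (suc t) (s≤s t<k) = get-applyUpTo k (λ z → h (suc z)) f t t<k

  map-applyUpTo-cong : ∀ k (h : ℕ → ℕ) (f g : ℕ → ℕ) → (∀ t → t < k → f (h t) ≡ g (h t)) →
                       map f (applyUpTo h k) ≡ map g (applyUpTo h k)
  map-applyUpTo-cong zero    h f g eq = refl
  map-applyUpTo-cong (suc k) h f g eq =
    cong₂ _∷_ (eq 0 (s≤s z≤n)) (map-applyUpTo-cong k (λ z → h (suc z)) f g (λ t t<k → eq (suc t) (s≤s t<k)))

  get-mk : ∀ k f t → t < k → get (mk k f) t ≡ f t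
  get-mk k f t t<k = get-applyUpTo k (λ z → z) f t t<k

  mk-cong : ∀ k f g → (∀ t → t < k → f t ≡ g t) → mk k f ≡ mk k g
  mk-cong k f g eq = map-applyUpTo-cong k (λ z → z) f g eq

  label : ℕ → List ℕ → List ℕ
  label k ι = mk k (λ t → atLeast t ι)

  label-[] : ∀ k → label k [] ≡ rootLabel k
  label-[] k = map-const-applyUpTo k (λ z → z)
    where map-const-applyUpTo : ∀ k (g : ℕ → ℕ) → map (λ t → atLeast t []) (applyUpTo g k) ≡ replicate k 0
          map-const-applyUpTo zero    g = refl
          map-const-applyUpTo (suc k) g = cong (0 ∷_) (map-const-applyUpTo k (λ z → g (suc z)))

  module Labels (k : ℕ) (ι : List ℕ) where
    open Rules k (label k ι) using (rule1; rule2; rule3; rule4; rule5a; rule5b)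

    get-label : ∀ t → t < k → get (label k ι) t ≡ atLeast t ι
    get-label t t<k = get-mk k (λ t → atLeast t ι) t t<k

    label-addFixed : label k (addFixed ι) ≡ rule1
    label-addFixed = mk-cong k _ _ pointwise
      where
      pointwise : ∀ t → t < k → atLeast t (addFixed ι) ≡ (if t ≡ᵇ 1 then get (label k ι) 0 else get (label k ι) t)
      pointwise zero          t<k = trans (atLeast-addFixed-≤1 ι z≤n) (trans (sym (atLeast-0 ι)) (sym (get-label 0 t<k)))
      pointwise (suc zero)    t<k = trans (atLeast-addFixed-≤1 ι ≤-refl)
                                      (trans (sym (atLeast-0 ι)) (sym (get-label 0 (≤-trans (s≤s z≤n) t<k))))
      pointwise (suc (suc t)) t<k = trans (atLeast-addFixed-≥2 ι (s≤s (s≤s z≤n))) (sym (get-label _ t<k))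

    label-addSemi : label k (addSemi ι) ≡ rule2
    label-addSemi = mk-cong k _ _ pointwise
      where
      pointwise : ∀ t → t < k → atLeast t (addSemi ι) ≡ (if t ≡ᵇ 0 then suc (get (label k ι) 0) else get (label k ι) t)
      pointwise zero    t<k = trans (atLeast-++ 0 ι (0 ∷ [])) (trans (+-comm _ 1) (cong suc (sym (get-label 0 t<k))))
      pointwise (suc t) t<k = trans (atLeast-++ (suc t) ι (0 ∷ [])) (trans (+-identityʳ _) (sym (get-label _ t<k)))

    module _ (dι : Decreasing ι) (r : Fin (length ι)) where
      private
        d : ℕ
        d = lookup ι r

        pred+1 : ∀ {c} → c ≡ length ι → c ∸ 1 + 1 ≡ c
        pred+1 {suc c} _  = +-comm c 1
        pred+1 {zero}  eq = nonempty ι r eq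
          where nonempty : ∀ ι → Fin (length ι) → 0 ≡ length ι → 0 ∸ 1 + 1 ≡ 0
                nonempty (x ∷ ι) r ()

        atLeast-closeSemi-< : ∀ o {t} → t < suc d → atLeast t (closeSemi ι r o) ≡ atLeast t ι ∸ 1 + atLeast t (zeroIf o)
        atLeast-closeSemi-< o t<d+1 = atLeast-closeSemi-≤ ι dι r o (≤-pred t<d+1)

      label-closeSemi-open : label k (closeSemi ι r true) ≡ rule3 (suc d) (toℕ r)
      label-closeSemi-open = mk-cong k _ _ pointwise
        where
        pointwise : ∀ t → t < k → atLeast t (closeSemi ι r true) ≡
                    (if t ≡ᵇ suc d then toℕ r
                     else if (1 ≤ᵇ t) ∧ (t <ᵇ suc d) then get (label k ι) t ∸ 1 else get (label k ι) t)
        pointwise t t<k with <-cmp t (suc d)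
        pointwise zero t<k | tri< t<d+1 _ _ rewrite ≡ᵇ-false {0} {suc d} (λ ())
          = trans (atLeast-closeSemi-< true t<d+1) (trans (pred+1 (atLeast-0 ι)) (sym (get-label 0 t<k)))
        pointwise (suc t) t<k | tri< t<d+1 _ _ rewrite ≡ᵇ-false (<⇒≢ t<d+1) | <ᵇ-true t<d+1
          = trans (atLeast-closeSemi-< true t<d+1) (trans (+-identityʳ _) (cong (_∸ 1) (sym (get-label _ t<k))))
        pointwise t t<k | tri≈ _ refl _ rewrite ≡ᵇ-true (suc d) = atLeast-closeSemi-≡ ι dι r true
        pointwise (suc t) t<k | tri> _ t≢d+1 d+1<t rewrite ≡ᵇ-false t≢d+1 | <ᵇ-false (<⇒≯ d+1<t)
          = trans (atLeast-closeSemi-> ι dι r true d+1<t) (sym (get-label _ t<k))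

      label-closeSemi-end : label k (closeSemi ι r false) ≡ rule4 (suc d) (toℕ r)
      label-closeSemi-end = mk-cong k _ _ pointwise
        where
        pointwise : ∀ t → t < k → atLeast t (closeSemi ι r false) ≡
                    (if t ≡ᵇ suc d then toℕ r else if t <ᵇ suc d then get (label k ι) t ∸ 1 else get (label k ι) t)
        pointwise t t<k with <-cmp t (suc d)
        pointwise t t<k | tri< t<d+1 t≢d+1 _ rewrite ≡ᵇ-false t≢d+1 | <ᵇ-true t<d+1
          = trans (atLeast-closeSemi-< false t<d+1) (trans (+-identityʳ _) (cong (_∸ 1) (sym (get-label _ t<k))))
        pointwise t t<k | tri≈ _ refl _ rewrite ≡ᵇ-true (suc d) = atLeast-closeSemi-≡ ι dι r false
        pointwise t t<k | tri> _ t≢d+1 d+1<t rewrite ≡ᵇ-false t≢d+1 | <ᵇ-false (<⇒≯ d+1<t)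
          = trans (atLeast-closeSemi-> ι dι r false d+1<t) (sym (get-label _ t<k))

      module _ (d+1≡k : suc d ≡ k) where
        label-closeSemi-open-top : label k (closeSemi ι r true) ≡ rule5a
        label-closeSemi-open-top = mk-cong k _ _ pointwise
          where
          pointwise : ∀ t → t < k → atLeast t (closeSemi ι r true) ≡ (if t ≡ᵇ 0 then get (label k ι) 0 else get (label k ι) t ∸ 1)
          pointwise zero    t<k = trans (atLeast-closeSemi-< true (s≤s z≤n)) (trans (pred+1 (atLeast-0 ι)) (sym (get-label 0 t<k)))
          pointwise (suc t) t<k = trans (atLeast-closeSemi-< true (subst (suc t <_) (sym d+1≡k) t<k))
                                    (trans (+-identityʳ _) (cong (_∸ 1) (sym (get-label _ t<k))))

        label-closeSemi-end-top : label k (closeSemi ι r false) ≡ rule5b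
        label-closeSemi-end-top = mk-cong k _ _ pointwise
          where
          pointwise : ∀ t → t < k → atLeast t (closeSemi ι r false) ≡ get (label k ι) t ∸ 1
          pointwise t t<k = trans (atLeast-closeSemi-< false (subst (t <_) (sym d+1≡k) t<k))
                              (trans (+-identityʳ _) (cong (_∸ 1) (sym (get-label _ t<k))))

  -- A move appends a vertex that is a fixed point, opens a new semi-arc, or closes the r-th
  -- semi-arc (opening a new one iff o).  Closing raises every entry left of r to at least
  -- d + 1 where d is the r-th entry, so when d + 1 = k only r = 0 is closable.
  closable : ℕ → (ι : List ℕ) → Fin (length ι) → Bool
  closable k ι r = (toℕ r ≡ᵇ 0) ∨ (suc (lookup ι r) <ᵇ k)

  data Move (k : ℕ) (ι : List ℕ) : Set where
    fixed opening : Move k ι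
    closing : (r : Fin (length ι)) (o : Bool) → T (closable k ι r) → Move k ι

  afterMove : ∀ {k ι} → Move k ι → List ℕ
  afterMove {ι = ι} fixed           = addFixed ι
  afterMove {ι = ι} opening         = addSemi ι
  afterMove {ι = ι} (closing r o _) = closeSemi ι r o

  closing-cong : ∀ {k ι} {r r′ : Fin (length ι)} o (v : T (closable k ι r)) (v′ : T (closable k ι r′)) →
                 toℕ r ≡ toℕ r′ → _≡_ {A = Move k ι} (closing r o v) (closing r′ o v′)
  closing-cong o v v′ eq with toℕ-injective eq
  ... | refl rewrite T-irrelevant v v′ = refl

  suc<⇒<∸1 : ∀ {k x} → suc x < k → x < k ∸ 1
  suc<⇒<∸1 {suc k} (s≤s x<k) = x<k

  <∸1⇒suc< : ∀ {k x} → x < k ∸ 1 → suc x < k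
  <∸1⇒suc< {suc k} x<k = s≤s x<k

  ∸1<self : ∀ {k} → 1 ≤ k → k ∸ 1 < k
  ∸1<self {suc k} _ = ≤-refl

  ∸1≤⇒≤suc : ∀ {k x} → k ∸ 1 ≤ x → k ≤ suc x
  ∸1≤⇒≤suc {zero}  _ = z≤n
  ∸1≤⇒≤suc {suc k} p = s≤s p

  Admissible : ℕ → ℕ → List ℕ → Set
  Admissible k g ι = g ≤ k × All (_< k) ι

  admissible-addFixed : ∀ {k g ι} → 2 ≤ k → Admissible k g ι → Admissible k (g ⊔ 1) (addFixed ι)
  admissible-addFixed 2≤k (g≤k , ι<k) = ⊔-lub g≤k (≤-trans (s≤s z≤n) 2≤k) , gmap⁺ (λ x<k → ⊔-lub x<k 2≤k) ι<k

  admissible-addFixed⁻ : ∀ {k g ι} → Admissible k (g ⊔ 1) (addFixed ι) → Admissible k g ι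
  admissible-addFixed⁻ {g = g} (g⊔1≤k , ι<k) =
    ≤-trans (m≤m⊔n g 1) g⊔1≤k , gmap⁻ (λ x⊔1<k → ≤-<-trans (m≤m⊔n _ 1) x⊔1<k) ι<k

  admissible-addSemi : ∀ {k g ι} → 2 ≤ k → Admissible k g ι → Admissible k g (addSemi ι)
  admissible-addSemi 2≤k (g≤k , ι<k) = g≤k , ++⁺ ι<k (≤-trans (s≤s z≤n) 2≤k ∷ [])

  admissible-addSemi⁻ : ∀ {k g ι} → Admissible k g (addSemi ι) → Admissible k g ι
  admissible-addSemi⁻ {ι = ι} (g≤k , ι<k) = g≤k , ++⁻ˡ ι ι<k

  admissible-closeSemi : ∀ {k g} ι (r : Fin (length ι)) o → 2 ≤ k → Admissible k g ι → T (closable k ι r) →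
                         Admissible k (g ⊔ suc (lookup ι r)) (closeSemi ι r o)
  admissible-closeSemi {k} ι r o 2≤k (g≤k , ι<k) v = ⊔-lub g≤k (All-lookup ι<k r) , closed<k ι ι<k r v
    where
    closed<k : ∀ ι → All (_< k) ι → (r : Fin (length ι)) → T (closable k ι r) → All (_< k) (closeSemi ι r o)
    closed<k (x ∷ ι) (_ ∷ ι<k) zero    v = ++⁺ ι<k (All-zeroIf o (≤-trans (s≤s z≤n) 2≤k))
    closed<k (x ∷ ι) ι<k       (suc r) v =
      All-closeWith (lookup ι r) (x ∷ ι) (suc (toℕ r)) o ι<k (≤-trans (s≤s z≤n) 2≤k) (λ y<k → ⊔-lub y<k (<ᵇ⇒< _ _ v))

  admissible-closeSemi⁻ : ∀ {k g} ι (r : Fin (length ι)) o → Admissible k (g ⊔ suc (lookup ι r)) (closeSemi ι r o) →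
                          Admissible k g ι × T (closable k ι r)
  admissible-closeSemi⁻ {k} {g} ι r o (g′≤k , closed<k) =
    (≤-trans (m≤m⊔n g _) g′≤k , ι<k ι r ιr<k closed<k) , closable-of ι r closed<k
    where
    ιr<k : lookup ι r < k
    ιr<k = ≤-trans (m≤n⊔m g _) g′≤k
    ι<k : ∀ ι (r : Fin (length ι)) → lookup ι r < k → All (_< k) (closeSemi ι r o) → All (_< k) ι
    ι<k (x ∷ ι) zero    x<k closed<k         = x<k ∷ ++⁻ˡ ι closed<k
    ι<k (x ∷ ι) (suc r) ιr<k (x′<k ∷ closed<k) = ≤-<-trans (m≤m⊔n x _) x′<k ∷ ι<k ι r ιr<k closed<k
    closable-of : ∀ ι (r : Fin (length ι)) → All (_< k) (closeSemi ι r o) → T (closable k ι r)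
    closable-of (x ∷ ι) zero    _          = tt
    closable-of (x ∷ ι) (suc r) (x′<k ∷ _) = <⇒<ᵇ (≤-<-trans (m≤n⊔m x _) x′<k)

  -- The moves from a profile are in label-preserving bijection with the children of its label:
  -- closing a semi-arc of index d = j - 1 at position r gives rule (3)/(4) with i = r, since
  -- the semi-arcs of index j - 1 occupy the positions s_j ≤ r < s_{j-1}; the case d + 1 = k is rule (5).
  module MoveEnumeration (k : ℕ) (2≤k : 2 ≤ k) (ι : List ℕ) (dι : Decreasing ι) (ι<k : All (_< k) ι) where
    open Labels k ι
    open Rules k (label k ι) using (rule1; rule2; rule3; rule4; rule5a; rule5b; children; js; range)

    s : ℕ → ℕ
    s = get (label k ι)

    ClosingShape : Set
    ClosingShape = Σ (Fin (k ∸ 1)) (λ d → Σ (Fin (s (toℕ d) ∸ s (suc (toℕ d)))) (λ _ → Bool))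

    hasRule5 : Bool
    hasRule5 = 0 <ᵇ s (k ∸ 1)

    ChildShape : Set
    ChildShape = ⊤ ⊎ (⊤ ⊎ (ClosingShape ⊎ (T hasRule5 × Bool)))

    rule34 : ℕ → ℕ → Bool → List ℕ
    rule34 j i o = if o then rule3 j i else rule4 j i

    shapeLabel : ChildShape → List ℕ
    shapeLabel = [ (λ _ → rule1) , [ (λ _ → rule2) ,
                 [ (λ { (d , b , o) → rule34 (suc (toℕ d)) (s (suc (toℕ d)) + toℕ b) o })
                 , (λ { (_ , o) → if o then rule5a else rule5b }) ]′ ]′ ]′

    enum-childShapes : Enum shapeLabel children
    enum-childShapes =
      enum-∷ (enum-∷ (enum-++ enum-closingShapes (enum-if hasRule5 rule5a rule5b)))
      where
      js≡ : js ≡ applyUpTo suc (k ∸ 1)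
      js≡ = map-upTo suc (k ∸ 1)
      range≡ : ∀ j → range j ≡ applyUpTo (s j +_) (s (j ∸ 1) ∸ s j)
      range≡ j = map-upTo (s j +_) _
      enum-closingShapes : Enum {A = ClosingShape} (λ { (d , b , o) → rule34 (suc (toℕ d)) (s (suc (toℕ d)) + toℕ b) o })
                             (concat (map (λ j → concat (map (λ i → rule3 j i ∷ rule4 j i ∷ []) (range j))) js))
      enum-closingShapes =
        enum-Σ (λ j → concat (map (λ i → rule3 j i ∷ rule4 j i ∷ []) (range j)))
          (enum-subst (sym js≡) (enum-applyUpTo (k ∸ 1) suc))
          (λ d → enum-Σ (λ i → rule3 (suc (toℕ d)) i ∷ rule4 (suc (toℕ d)) i ∷ [])
                   (enum-subst (sym (range≡ (suc (toℕ d)))) (enum-applyUpTo _ (s (suc (toℕ d)) +_)))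
                   (λ b → enum-Bool (rule3 (suc (toℕ d)) (s (suc (toℕ d)) + toℕ b))
                                    (rule4 (suc (toℕ d)) (s (suc (toℕ d)) + toℕ b))))

    k∸1<k : k ∸ 1 < k
    k∸1<k = ∸1<self (≤-trans (s≤s z≤n) 2≤k)

    s≡atLeast : ∀ t → t < k → s t ≡ atLeast t ι
    s≡atLeast = get-label

    suc-d<k : (d : Fin (k ∸ 1)) → suc (toℕ d) < k
    suc-d<k d = <∸1⇒suc< (toℕ<n d)

    d<k : (d : Fin (k ∸ 1)) → toℕ d < k
    d<k d = ≤-trans (n≤1+n _) (suc-d<k d)

    lookup<k : (r : Fin (length ι)) → lookup ι r < k
    lookup<k = All-lookup ι<k

    s≤length : ∀ t → t < k → s t ≤ length ι
    s≤length t t<k = subst (_≤ length ι) (sym (s≡atLeast t t<k)) (atLeast≤length t ι)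

    atLeast[d+1]≤r : (r : Fin (length ι)) → atLeast (suc (lookup ι r)) ι ≤ toℕ r
    atLeast[d+1]≤r r with atLeast (suc (lookup ι r)) ι ≤? toℕ r
    ... | yes p = p
    ... | no p  = ⊥-elim (<-irrefl refl (<atLeast⇒≤lookup ι dι r (≰⇒> p)))

    r<atLeast[d] : (r : Fin (length ι)) → toℕ r < atLeast (lookup ι r) ι
    r<atLeast[d] r = ≤lookup⇒<atLeast ι dι r ≤-refl

    first : ∀ {m} → 0 < m → Fin m
    first {suc m} _ = zero

    toℕ-first : ∀ {m} (p : 0 < m) → toℕ (first p) ≡ 0
    toℕ-first {suc m} _ = refl

    closable-first : ∀ ι′ (p : 0 < length ι′) → T (closable k ι′ (first p))
    closable-first (x ∷ ι′) _ = tt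

    offset<gap : (r : Fin (length ι)) → suc (lookup ι r) < k →
                 toℕ r ∸ s (suc (lookup ι r)) < s (lookup ι r) ∸ s (suc (lookup ι r))
    offset<gap r d+1<k rewrite s≡atLeast (suc (lookup ι r)) d+1<k | s≡atLeast (lookup ι r) (<-trans (n<1+n _) d+1<k) =
      ∸-monoˡ-< (r<atLeast[d] r) (atLeast[d+1]≤r r)

    depthOf : (r : Fin (length ι)) → suc (lookup ι r) < k → Fin (k ∸ 1)
    depthOf r d+1<k = fromℕ< {m = lookup ι r} (suc<⇒<∸1 d+1<k)

    toℕ-depthOf : (r : Fin (length ι)) (d+1<k : suc (lookup ι r) < k) → toℕ (depthOf r d+1<k) ≡ lookup ι r
    toℕ-depthOf r d+1<k = toℕ-fromℕ< _

    offsetOf< : (r : Fin (length ι)) (d+1<k : suc (lookup ι r) < k) →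
                toℕ r ∸ s (suc (toℕ (depthOf r d+1<k))) < s (toℕ (depthOf r d+1<k)) ∸ s (suc (toℕ (depthOf r d+1<k)))
    offsetOf< r d+1<k = subst (λ d → toℕ r ∸ s (suc d) < s d ∸ s (suc d)) (sym (toℕ-depthOf r d+1<k)) (offset<gap r d+1<k)

    offsetOf : (r : Fin (length ι)) (d+1<k : suc (lookup ι r) < k) →
               Fin (s (toℕ (depthOf r d+1<k)) ∸ s (suc (toℕ (depthOf r d+1<k))))
    offsetOf r d+1<k = fromℕ< (offsetOf< r d+1<k)

    rule5-nonempty : (r : Fin (length ι)) → suc (lookup ι r) ≡ k → T hasRule5
    rule5-nonempty r d+1≡k = <⇒<ᵇ (subst (0 <_) (sym (s≡atLeast (k ∸ 1) k∸1<k))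
                               (subst (λ z → 0 < atLeast z ι) (cong (_∸ 1) d+1≡k) (≤-<-trans z≤n (r<atLeast[d] r))))

    shapeOfClosing : (r : Fin (length ι)) → Bool → Dec (suc (lookup ι r) < k) → ChildShape
    shapeOfClosing r o (yes d+1<k) = inj₂ (inj₂ (inj₁ (depthOf r d+1<k , offsetOf r d+1<k , o)))
    shapeOfClosing r o (no d+1≮k)  = inj₂ (inj₂ (inj₂ (rule5-nonempty r (≤-antisym (lookup<k r) (≮⇒≥ d+1≮k)) , o)))

    shapeOf : Move k ι → ChildShape
    shapeOf fixed           = inj₁ tt
    shapeOf opening         = inj₂ (inj₁ tt)
    shapeOf (closing r o _) = shapeOfClosing r o (suc (lookup ι r) <? k)

    s-antitone : (d : Fin (k ∸ 1)) → s (suc (toℕ d)) ≤ s (toℕ d)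
    s-antitone d rewrite s≡atLeast _ (suc-d<k d) | s≡atLeast _ (d<k d) = atLeast-antitone ι (n≤1+n _)

    position : (d : Fin (k ∸ 1)) → Fin (s (toℕ d) ∸ s (suc (toℕ d))) → ℕ
    position d b = s (suc (toℕ d)) + toℕ b

    position<s : ∀ d b → position d b < s (toℕ d)
    position<s d b = subst (position d b <_) (m+[n∸m]≡n (s-antitone d)) (+-monoʳ-< (s (suc (toℕ d))) (toℕ<n b))

    position<length : ∀ d b → position d b < length ι
    position<length d b = <-≤-trans (position<s d b) (s≤length _ (d<k d))

    positionFin : ∀ d b → Fin (length ι)
    positionFin d b = fromℕ< (position<length d b)

    lookup-positionFin : ∀ d b → lookup ι (positionFin d b) ≡ toℕ d
    lookup-positionFin d b = ≤-antisym ≤d d≤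
      where
      toℕ-r : toℕ (positionFin d b) ≡ position d b
      toℕ-r = toℕ-fromℕ< (position<length d b)
      d≤ : toℕ d ≤ lookup ι (positionFin d b)
      d≤ = <atLeast⇒≤lookup ι dι (positionFin d b) (subst₂ _<_ (sym toℕ-r) (s≡atLeast _ (d<k d)) (position<s d b))
      ≤d : lookup ι (positionFin d b) ≤ toℕ d
      ≤d with suc (toℕ d) ≤? lookup ι (positionFin d b)
      ... | no d+1≰ = ≤-pred (≰⇒> d+1≰)
      ... | yes d+1≤ = ⊥-elim (<-irrefl refl (<-≤-trans
                         (subst₂ _<_ toℕ-r (sym (s≡atLeast _ (suc-d<k d))) (≤lookup⇒<atLeast ι dι (positionFin d b) d+1≤))
                         (m≤m+n _ (toℕ b))))

    closable-positionFin : ∀ d b → T (closable k ι (positionFin d b))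
    closable-positionFin d b =
      Equivalence.from T-∨ (inj₂ (<⇒<ᵇ (subst (λ z → suc z < k) (sym (lookup-positionFin d b)) (suc-d<k d))))

    nonempty : T hasRule5 → 0 < length ι
    nonempty p = <-≤-trans (<ᵇ⇒< 0 (s (k ∸ 1)) p) (s≤length _ k∸1<k)

    moveOf : ChildShape → Move k ι
    moveOf (inj₁ _)                         = fixed
    moveOf (inj₂ (inj₁ _))                  = opening
    moveOf (inj₂ (inj₂ (inj₁ (d , b , o)))) = closing (positionFin d b) o (closable-positionFin d b)
    moveOf (inj₂ (inj₂ (inj₂ (p , o))))     = closing (first (nonempty p)) o (closable-first ι (nonempty p))

    position-offsetOf : (r : Fin (length ι)) (d+1<k : suc (lookup ι r) < k) →
                        s (suc (toℕ (depthOf r d+1<k))) + toℕ (offsetOf r d+1<k) ≡ toℕ r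
    position-offsetOf r d+1<k rewrite toℕ-fromℕ< (offsetOf< r d+1<k) | toℕ-depthOf r d+1<k | s≡atLeast (suc (lookup ι r)) d+1<k =
      m+[n∸m]≡n (atLeast[d+1]≤r r)

    closingShape-≡ : ∀ {d d′ : Fin (k ∸ 1)} (b : Fin (s (toℕ d) ∸ s (suc (toℕ d))))
                     (b′ : Fin (s (toℕ d′) ∸ s (suc (toℕ d′)))) o →
                     toℕ d′ ≡ toℕ d → toℕ b′ ≡ toℕ b → _≡_ {A = ClosingShape} (d′ , b′ , o) (d , b , o)
    closingShape-≡ b b′ o d≡ b≡ with toℕ-injective d≡
    ... | refl with toℕ-injective b≡
    ...   | refl = refl

    first-not-below-k : ∀ (p : T hasRule5) → ¬ (suc (lookup ι (first (nonempty p))) < k)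
    first-not-below-k p d+1<k = <-irrefl refl (<-≤-trans d+1<k (∸1≤⇒≤suc (<atLeast⇒≤lookup ι dι (first (nonempty p))
      (subst₂ _<_ (sym (toℕ-first (nonempty p))) (s≡atLeast (k ∸ 1) k∸1<k) (<ᵇ⇒< 0 (s (k ∸ 1)) p)))))

    moveOf-shapeOf : ∀ m → moveOf (shapeOf m) ≡ m
    moveOf-shapeOf fixed   = refl
    moveOf-shapeOf opening = refl
    moveOf-shapeOf (closing r o v) with suc (lookup ι r) <? k
    ... | yes d+1<k = closing-cong o _ v (trans (toℕ-fromℕ< (position<length (depthOf r d+1<k) (offsetOf r d+1<k)))
                                                (position-offsetOf r d+1<k))
    ... | no d+1≮k = closing-cong o _ v (trans (toℕ-first _) (sym (≡ᵇ⇒≡ (toℕ r) 0 r≡ᵇ0)))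
      where r≡ᵇ0 : T (toℕ r ≡ᵇ 0)
            r≡ᵇ0 = [ id , (λ t → ⊥-elim (d+1≮k (<ᵇ⇒< _ _ t))) ]′ (Equivalence.to T-∨ v)

    shapeOf-moveOf : ∀ sh → shapeOf (moveOf sh) ≡ sh
    shapeOf-moveOf (inj₁ tt)        = refl
    shapeOf-moveOf (inj₂ (inj₁ tt)) = refl
    shapeOf-moveOf (inj₂ (inj₂ (inj₁ (d , b , o)))) with suc (lookup ι (positionFin d b)) <? k
    ... | yes d+1<k = cong (λ z → inj₂ (inj₂ (inj₁ z))) (closingShape-≡ b (offsetOf r d+1<k) o d≡ b≡)
      where
      r : Fin (length ι)
      r = positionFin d b
      d≡ : toℕ (depthOf r d+1<k) ≡ toℕ d
      d≡ = trans (toℕ-depthOf r d+1<k) (lookup-positionFin d b)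
      b≡ : toℕ (offsetOf r d+1<k) ≡ toℕ b
      b≡ rewrite toℕ-fromℕ< (offsetOf< r d+1<k) | d≡ | toℕ-fromℕ< (position<length d b) = m+n∸m≡n (s (suc (toℕ d))) (toℕ b)
    ... | no d+1≮k = ⊥-elim (d+1≮k (subst (λ z → suc z < k) (sym (lookup-positionFin d b)) (suc-d<k d)))
    shapeOf-moveOf (inj₂ (inj₂ (inj₂ (p , o)))) with suc (lookup ι (first (nonempty p))) <? k
    ... | yes d+1<k = ⊥-elim (first-not-below-k p d+1<k)
    ... | no _      = cong (λ z → inj₂ (inj₂ (inj₂ (z , o)))) (T-irrelevant _ p)

    shapeLabel-shapeOf : ∀ m → shapeLabel (shapeOf m) ≡ label k (afterMove m)
    shapeLabel-shapeOf fixed   = sym label-addFixed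
    shapeLabel-shapeOf opening = sym label-addSemi
    shapeLabel-shapeOf (closing r o v) with suc (lookup ι r) <? k
    shapeLabel-shapeOf (closing r true v)  | yes d+1<k =
      trans (cong₂ rule3 (cong suc (toℕ-depthOf r d+1<k)) (position-offsetOf r d+1<k)) (sym (label-closeSemi-open dι r))
    shapeLabel-shapeOf (closing r false v) | yes d+1<k =
      trans (cong₂ rule4 (cong suc (toℕ-depthOf r d+1<k)) (position-offsetOf r d+1<k)) (sym (label-closeSemi-end dι r))
    shapeLabel-shapeOf (closing r true v)  | no d+1≮k = sym (label-closeSemi-open-top dι r (≤-antisym (lookup<k r) (≮⇒≥ d+1≮k)))
    shapeLabel-shapeOf (closing r false v) | no d+1≮k = sym (label-closeSemi-end-top dι r (≤-antisym (lookup<k r) (≮⇒≥ d+1≮k)))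

    enum-moves : Enum {A = Move k ι} (λ m → label k (afterMove m)) children
    enum-moves = enum-relabel shapeLabel-shapeOf (enum-transport shapeOf moveOf shapeOf-moveOf moveOf-shapeOf enum-childShapes)


module Extension where

  open import Data.Nat using (ℕ; zero; suc; _+_; _≤_; _<_)
  open import Data.Nat.Properties using (<-irrefl; ≤-trans; ≤-pred; _<?_)
  open import Data.Fin using (Fin; zero; suc; toℕ; inject₁; fromℕ) renaming (_<_ to _<ᶠ_)
  open import Data.Fin.Properties using (toℕ-inject₁; toℕ-fromℕ; toℕ<n; inject₁-injective; fromℕ≢inject₁; suc-injective; _≟_)
  open import Data.Vec using (Vec; lookup; tabulate)
  open import Data.Vec.Properties using (lookup∘tabulate; tabulate∘lookup; tabulate-cong)
  open import Data.Maybe using (Maybe; just; nothing)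
  open import Data.Bool using (Bool; true; false; if_then_else_)
  open import Data.Product using (Σ; _×_; _,_)
  open import Data.Empty using (⊥; ⊥-elim)
  open import Data.Maybe.Properties using (just-injective)
  import Data.Empty.Irrelevant as Irr
  open import Relation.Nullary using (yes; no)
  open import Relation.Nullary.Decidable using (recompute)
  open import Relation.Binary.PropositionalEquality
  open import Defs

  outAt : ∀ {n} → Diagram n → Fin n → Out n
  outAt π v = lookup (out π) v

  lookup-ext : ∀ {A : Set} {n} {xs ys : Vec A n} → (∀ i → lookup xs i ≡ lookup ys i) → xs ≡ ys
  lookup-ext {xs = xs} {ys} p = trans (sym (tabulate∘lookup xs)) (trans (tabulate-cong p) (tabulate∘lookup ys))

  diagram-≡ : ∀ {n} {π π' : Diagram n} → out π ≡ out π' → π ≡ π'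
  diagram-≡ {π = diagram o w} {diagram .o w'} refl = refl

  diagram-ext : ∀ {n} {π π' : Diagram n} → (∀ v → outAt π v ≡ outAt π' v) → π ≡ π'
  diagram-ext p = diagram-≡ (lookup-ext p)

  data View {n : ℕ} : Fin (suc n) → Set where
    old : (v : Fin n) → View (inject₁ v)
    new : View (fromℕ n)

  view : ∀ {n} (i : Fin (suc n)) → View i
  view {zero} zero = new
  view {suc n} zero = old zero
  view {suc n} (suc i) with view i
  ... | old v = old (suc v)
  ... | new = new

  view-old : ∀ {n} (v : Fin n) → view (inject₁ v) ≡ old v
  view-old {suc n} zero = refl
  view-old {suc n} (suc v) rewrite view-old v = refl

  view-new : ∀ n → view (fromℕ n) ≡ new
  view-new zero = refl
  view-new (suc n) rewrite view-new n = refl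

  liftOut : ∀ {n} → Out n → Out (suc n)
  liftOut none = none
  liftOut semi = semi
  liftOut (arc b) = arc (inject₁ b)

  lowerOut : ∀ {n} → Out (suc n) → Out n
  lowerOut none = none
  lowerOut semi = semi
  lowerOut (arc b) with view b
  ... | old b' = arc b'
  ... | new = semi

  closeAt : ∀ {n} → Maybe (Fin n) → Fin n → Bool
  closeAt nothing v = false
  closeAt (just s) v with s ≟ v
  ... | yes _ = true
  ... | no _ = false

  closeAt-true : ∀ {n} {c : Maybe (Fin n)} {v} → closeAt c v ≡ true → c ≡ just v
  closeAt-true {c = just s} {v} p with s ≟ v
  closeAt-true {c = just s} {v} p | yes refl = refl
  closeAt-true {c = just s} {v} () | no _

  closeAt-self : ∀ {n} (v : Fin n) → closeAt (just v) v ≡ true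
  closeAt-self v with v ≟ v
  ... | yes _ = refl
  ... | no q = ⊥-elim (q refl)

  closeAt-≢ : ∀ {n} (s v : Fin n) → s ≢ v → closeAt (just s) v ≡ false
  closeAt-≢ s v q with s ≟ v
  ... | yes p = ⊥-elim (q p)
  ... | no _ = refl

  extendOutView : ∀ {n} → Diagram n → Bool → Maybe (Fin n) → (i : Fin (suc n)) → View i → Out (suc n)
  extendOutView π o c .(inject₁ v) (old v) = if closeAt c v then arc (fromℕ _) else liftOut (outAt π v)
  extendOutView π o c .(fromℕ _) new = if o then semi else none

  extendOut : ∀ {n} → Diagram n → Bool → Maybe (Fin n) → Fin (suc n) → Out (suc n)
  extendOut π o c i = extendOutView π o c i (view i)

  inject₁<fromℕ : ∀ {n} (v : Fin n) → inject₁ v <ᶠ fromℕ n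
  inject₁<fromℕ {n} v rewrite toℕ-inject₁ v | toℕ-fromℕ n = toℕ<n v

  liftOut-arc : ∀ {n} (x : Out n) {b} → liftOut x ≡ arc b → Σ (Fin n) λ b' → x ≡ arc b' × b ≡ inject₁ b'
  liftOut-arc (arc b') refl = b' , refl , refl
  liftOut-arc none ()
  liftOut-arc semi ()

  inject₁≢fromℕ : ∀ {n} (v : Fin n) → inject₁ v ≢ fromℕ n
  inject₁≢fromℕ v eq = fromℕ≢inject₁ (sym eq)

  arc-injective : ∀ {n} {x y : Fin n} → arc x ≡ arc y → x ≡ y
  arc-injective refl = refl

  open-or-none≢arc : ∀ {n} o {b : Fin n} → (if o then semi else none) ≢ arc b
  open-or-none≢arc true ()
  open-or-none≢arc false ()

  extend-wf : ∀ {n} (π : Diagram n) o c → WellFormed (tabulate (extendOut π o c))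
  extend-wf {n} (diagram ot w) o c = record { leftLess = leftLess′ ; rightOnce = rightOnce′ }
    where
    π : Diagram n
    π = diagram ot w
    lookup-tabulate : ∀ i → lookup (tabulate (extendOut π o c)) i ≡ extendOutView π o c i (view i)
    lookup-tabulate i = lookup∘tabulate (extendOut π o c) i
    leftLess-view : ∀ i (w : View i) b → extendOutView π o c i w ≡ arc b → i <ᶠ b
    leftLess-view .(inject₁ v) (old v) b eq with closeAt c v
    ... | true with eq
    ...   | refl = inject₁<fromℕ v
    leftLess-view .(inject₁ v) (old v) b eq | false with liftOut-arc (outAt π v) eq
    ...   | b' , e1 , refl rewrite toℕ-inject₁ v | toℕ-inject₁ b' =
             recompute (toℕ v <? toℕ b') (WellFormed.leftLess w v b' e1)
    leftLess-view .(fromℕ _) new b eq = ⊥-elim (open-or-none≢arc o eq)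
    leftLess′ : ∀ a b → lookup (tabulate (extendOut π o c)) a ≡ arc b → a <ᶠ b
    leftLess′ a b eq = leftLess-view a (view a) b (trans (sym (lookup-tabulate a)) eq)
    rightOnce-view : ∀ a (w : View a) a' (w' : View a') b →
                     extendOutView π o c a w ≡ arc b → extendOutView π o c a' w' ≡ arc b → a ≡ a'
    rightOnce-view .(fromℕ _) new a' w' b eq eq' = ⊥-elim (open-or-none≢arc o eq)
    rightOnce-view a (old v) .(fromℕ _) new b eq eq' = ⊥-elim (open-or-none≢arc o eq')
    rightOnce-view .(inject₁ v) (old v) .(inject₁ v') (old v') b eq eq' with closeAt c v in e1 | closeAt c v' in e2
    ... | true | true with trans (sym (closeAt-true {c = c} {v = v} e1)) (closeAt-true {c = c} {v = v'} e2)
    ...   | refl = refl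
    rightOnce-view .(inject₁ v) (old v) .(inject₁ v') (old v') b refl eq' | true | false with liftOut-arc (outAt π v') eq'
    ...   | b' , _ , e = Irr.⊥-elim (inject₁≢fromℕ b' (sym e))
    rightOnce-view .(inject₁ v) (old v) .(inject₁ v') (old v') b eq refl | false | true with liftOut-arc (outAt π v) eq
    ...   | b' , _ , e = Irr.⊥-elim (inject₁≢fromℕ b' (sym e))
    rightOnce-view .(inject₁ v) (old v) .(inject₁ v') (old v') b eq eq' | false | false
      with liftOut-arc (outAt π v) eq | liftOut-arc (outAt π v') eq'
    ...   | b1 , f1 , refl | b2 , f2 , e rewrite inject₁-injective e =
             cong inject₁ (recompute (v ≟ v') (WellFormed.rightOnce w v v' b2 f1 f2))
    rightOnce′ : ∀ a a' b → lookup (tabulate (extendOut π o c)) a ≡ arc b → lookup (tabulate (extendOut π o c)) a' ≡ arc b → a ≡ a'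
    rightOnce′ a a' b eq eq' = rightOnce-view a (view a) a' (view a') b (trans (sym (lookup-tabulate a)) eq) (trans (sym (lookup-tabulate a')) eq')

  -- extend π o c appends a vertex that closes the semi-arc starting at c (if any) into an arc
  -- and then opens a new semi-arc iff o; every diagram of size n+1 arises exactly once.
  extend : ∀ {n} → Diagram n → Bool → Maybe (Fin n) → Diagram (suc n)
  extend π o c = diagram (tabulate (extendOut π o c)) (extend-wf π o c)

  lowerOut-arc : ∀ {n} (x : Out (suc n)) {b'} → lowerOut x ≡ arc b' → x ≡ arc (inject₁ b')
  lowerOut-arc none ()
  lowerOut-arc semi ()
  lowerOut-arc (arc b) eq with view b
  lowerOut-arc (arc .(inject₁ b'')) refl | old b'' = refl
  lowerOut-arc (arc .(fromℕ _)) () | new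

  restrict-wf : ∀ {n} (ot : Vec (Out (suc n)) (suc n)) → .(WellFormed ot) →
                WellFormed (tabulate (λ v → lowerOut (lookup ot (inject₁ v))))
  restrict-wf {n} ot w = record { leftLess = leftLess′ ; rightOnce = rightOnce′ }
    where
    lookup-tabulate : ∀ v → lookup (tabulate (λ v → lowerOut (lookup ot (inject₁ v)))) v ≡ lowerOut (lookup ot (inject₁ v))
    lookup-tabulate v = lookup∘tabulate _ v
    leftLess′ : ∀ a b → _ ≡ arc b → a <ᶠ b
    leftLess′ a b eq = subst₂ _<_ (toℕ-inject₁ a) (toℕ-inject₁ b)
                  (recompute (toℕ (inject₁ a) <? toℕ (inject₁ b))
                    (WellFormed.leftLess w (inject₁ a) (inject₁ b) (lowerOut-arc _ (trans (sym (lookup-tabulate a)) eq))))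
    rightOnce′ : ∀ a a' b → _ ≡ arc b → _ ≡ arc b → a ≡ a'
    rightOnce′ a a' b eq eq' = inject₁-injective (recompute (inject₁ a ≟ inject₁ a')
      (WellFormed.rightOnce w (inject₁ a) (inject₁ a') (inject₁ b)
        (lowerOut-arc _ (trans (sym (lookup-tabulate a)) eq)) (lowerOut-arc _ (trans (sym (lookup-tabulate a')) eq'))))

  restrict : ∀ {n} → Diagram (suc n) → Diagram n
  restrict (diagram ot w) = diagram (tabulate (λ v → lowerOut (lookup ot (inject₁ v)))) (restrict-wf ot w)

  outAt-restrict : ∀ {n} (π' : Diagram (suc n)) v → outAt (restrict π') v ≡ lowerOut (outAt π' (inject₁ v))
  outAt-restrict (diagram ot w) v = lookup∘tabulate _ v

  isSemi : ∀ {n} → Out n → Bool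
  isSemi semi = true
  isSemi _ = false

  isSemi-true : ∀ {n} {x : Out n} → isSemi x ≡ true → x ≡ semi
  isSemi-true {x = semi} _ = refl
  isSemi-true {x = none} ()
  isSemi-true {x = arc _} ()

  isSemi-liftOut : ∀ {n} (x : Out n) → isSemi (liftOut x) ≡ isSemi x
  isSemi-liftOut none = refl
  isSemi-liftOut semi = refl
  isSemi-liftOut (arc _) = refl

  isArcToLast : ∀ {n} → Out (suc n) → Bool
  isArcToLast none = false
  isArcToLast semi = false
  isArcToLast (arc b) with view b
  ... | old _ = false
  ... | new = true

  isArcToLast-true : ∀ {n} (x : Out (suc n)) → isArcToLast x ≡ true → x ≡ arc (fromℕ n)
  isArcToLast-true none ()
  isArcToLast-true semi ()
  isArcToLast-true (arc b) eq with view b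
  isArcToLast-true (arc .(inject₁ _)) () | old _
  isArcToLast-true (arc .(fromℕ _)) eq | new = refl

  isArcToLast-last : ∀ n → isArcToLast (arc (fromℕ n)) ≡ true
  isArcToLast-last n rewrite view-new n = refl

  isArcToLast-liftOut : ∀ {n} (x : Out n) → isArcToLast (liftOut x) ≡ false
  isArcToLast-liftOut none = refl
  isArcToLast-liftOut semi = refl
  isArcToLast-liftOut (arc b) rewrite view-old b = refl

  liftOut-lowerOut : ∀ {n} (x : Out (suc n)) → isArcToLast x ≡ false → liftOut (lowerOut x) ≡ x
  liftOut-lowerOut none _ = refl
  liftOut-lowerOut semi _ = refl
  liftOut-lowerOut (arc b) eq with view b
  liftOut-lowerOut (arc .(inject₁ b')) eq | old b' = refl
  liftOut-lowerOut (arc .(fromℕ _)) () | new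

  lowerOut-liftOut : ∀ {n} (x : Out n) → lowerOut (liftOut x) ≡ x
  lowerOut-liftOut none = refl
  lowerOut-liftOut semi = refl
  lowerOut-liftOut (arc b) rewrite view-old b = refl

  lowerOut-arcToLast : ∀ n → lowerOut {n} (arc (fromℕ n)) ≡ semi
  lowerOut-arcToLast n rewrite view-new n = refl

  firstWhere : ∀ {n} → (Fin n → Bool) → Maybe (Fin n)
  firstWhere {zero} p = nothing
  firstWhere {suc n} p with p zero
  ... | true = just zero
  ... | false with firstWhere (λ v → p (suc v))
  ...   | just v = just (suc v)
  ...   | nothing = nothing

  firstWhere-just : ∀ {n} (p : Fin n → Bool) {v} → firstWhere p ≡ just v → p v ≡ true
  firstWhere-just {suc n} p eq with p zero in e
  firstWhere-just {suc n} p refl | true = e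
  ... | false with firstWhere (λ v → p (suc v)) in e2
  firstWhere-just {suc n} p refl | false | just v = firstWhere-just (λ v → p (suc v)) e2
  firstWhere-just {suc n} p () | false | nothing

  firstWhere-nothing : ∀ {n} (p : Fin n → Bool) → firstWhere p ≡ nothing → ∀ v → p v ≡ false
  firstWhere-nothing {suc n} p eq v with p zero in e
  firstWhere-nothing {suc n} p () v | true
  ... | false with firstWhere (λ v → p (suc v)) in e2
  firstWhere-nothing {suc n} p () v | false | just _
  firstWhere-nothing {suc n} p refl zero | false | nothing = e
  firstWhere-nothing {suc n} p refl (suc v) | false | nothing = firstWhere-nothing (λ v → p (suc v)) e2 v

  firstWhere-none : ∀ {n} (p : Fin n → Bool) → (∀ v → p v ≡ false) → firstWhere p ≡ nothing
  firstWhere-none {zero} p h = refl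
  firstWhere-none {suc n} p h rewrite h zero | firstWhere-none (λ v → p (suc v)) (λ v → h (suc v)) = refl

  firstWhere-unique : ∀ {n} (p : Fin n → Bool) s → p s ≡ true → (∀ v → p v ≡ true → v ≡ s) → firstWhere p ≡ just s
  firstWhere-unique {suc n} p s ps u with p zero in e
  ... | true = cong just (u zero e)
  firstWhere-unique {suc n} p zero ps u | false with trans (sym e) ps
  ... | ()
  firstWhere-unique {suc n} p (suc s) ps u | false
    rewrite firstWhere-unique (λ v → p (suc v)) s ps (λ v q → suc-injective (u (suc v) q)) = refl

  lastOpens : ∀ {n} → Diagram (suc n) → Bool
  lastOpens {n} π' = isSemi (outAt π' (fromℕ n))

  lastCloses : ∀ {n} → Diagram (suc n) → Maybe (Fin n)
  lastCloses π' = firstWhere (λ v → isArcToLast (outAt π' (inject₁ v)))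

  outAt-extend : ∀ {n} (π : Diagram n) o c i → outAt (extend π o c) i ≡ extendOutView π o c i (view i)
  outAt-extend π o c i = lookup∘tabulate (extendOut π o c) i

  outAt-extend-inject₁ : ∀ {n} (π : Diagram n) o c v →
                         outAt (extend π o c) (inject₁ v) ≡ (if closeAt c v then arc (fromℕ n) else liftOut (outAt π v))
  outAt-extend-inject₁ π o c v rewrite outAt-extend π o c (inject₁ v) | view-old v = refl

  outAt-extend-fromℕ : ∀ {n} (π : Diagram n) o c → outAt (extend π o c) (fromℕ n) ≡ (if o then semi else none)
  outAt-extend-fromℕ {n} π o c rewrite outAt-extend π o c (fromℕ n) | view-new n = refl

  lastOpens-extend : ∀ {n} (π : Diagram n) o c → lastOpens (extend π o c) ≡ o
  lastOpens-extend π true c rewrite outAt-extend-fromℕ π true c = refl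
  lastOpens-extend π false c rewrite outAt-extend-fromℕ π false c = refl

  isArcToLast-extend : ∀ {n} (π : Diagram n) o c v → isArcToLast (outAt (extend π o c) (inject₁ v)) ≡ closeAt c v
  isArcToLast-extend {n} π o c v rewrite outAt-extend-inject₁ π o c v with closeAt c v
  ... | true = isArcToLast-last n
  ... | false = isArcToLast-liftOut (outAt π v)

  lastCloses-extend : ∀ {n} (π : Diagram n) o c → lastCloses (extend π o c) ≡ c
  lastCloses-extend π o nothing = firstWhere-none _ (λ v → isArcToLast-extend π o nothing v)
  lastCloses-extend π o (just s) = firstWhere-unique _ s (trans (isArcToLast-extend π o (just s) s) (closeAt-self s))
    (λ v q → sym (just-injective (closeAt-true {c = just s} (trans (sym (isArcToLast-extend π o (just s) v)) q))))

  ClosesSemi : ∀ {n} → Diagram n → Maybe (Fin n) → Set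
  ClosesSemi π c = ∀ s → c ≡ just s → outAt π s ≡ semi

  restrict-extend : ∀ {n} (π : Diagram n) o c → ClosesSemi π c → restrict (extend π o c) ≡ π
  restrict-extend π o c pr = diagram-ext λ v →
    trans (outAt-restrict (extend π o c) v) (trans (cong lowerOut (outAt-extend-inject₁ π o c v)) (lowerOut-extended v))
    where
    lowerOut-extended : ∀ v → lowerOut (if closeAt c v then arc (fromℕ _) else liftOut (outAt π v)) ≡ outAt π v
    lowerOut-extended v with closeAt c v in e
    ... | true = trans (lowerOut-arcToLast _) (sym (pr v (closeAt-true e)))
    ... | false = lowerOut-liftOut (outAt π v)

  closesSemi-lastCloses : ∀ {n} (π' : Diagram (suc n)) → ClosesSemi (restrict π') (lastCloses π')
  closesSemi-lastCloses {n} π' s eq = trans (outAt-restrict π' s)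
    (trans (cong lowerOut (isArcToLast-true (outAt π' (inject₁ s)) (firstWhere-just (λ v → isArcToLast (outAt π' (inject₁ v))) eq)))
           (lowerOut-arcToLast n))

  extend-restrict : ∀ {n} (π' : Diagram (suc n)) → extend (restrict π') (lastOpens π') (lastCloses π') ≡ π'
  extend-restrict {n} (diagram ot w) = diagram-ext λ i → trans (outAt-extend π₀ (lastOpens π') (lastCloses π') i) (outAt-view i (view i))
    where
    π' : Diagram (suc n)
    π' = diagram ot w
    π₀ : Diagram n
    π₀ = restrict π'
    p : Fin n → Bool
    p v = isArcToLast (lookup ot (inject₁ v))
    outAt-view : ∀ i (wv : View i) → extendOutView π₀ (lastOpens π') (lastCloses π') i wv ≡ lookup ot i
    outAt-view .(inject₁ v) (old v) with closeAt (lastCloses π') v in e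
    ... | true = sym (isArcToLast-true _ (firstWhere-just p (closeAt-true e)))
    ... | false = trans (cong liftOut (outAt-restrict π' v)) (liftOut-lowerOut _ noArc)
      where
      noArc : isArcToLast (lookup ot (inject₁ v)) ≡ false
      noArc with isArcToLast (lookup ot (inject₁ v)) in e'
      ... | false = refl
      ... | true with firstWhere p in e3
      ...   | nothing = trans (sym e') (firstWhere-nothing p e3 v)
      ...   | just s = ⊥-elim (ne (inject₁-injective (recompute (inject₁ s ≟ inject₁ v)
                          (WellFormed.rightOnce w (inject₁ s) (inject₁ v) (fromℕ n)
                             (isArcToLast-true _ (firstWhere-just p e3)) (isArcToLast-true _ e')))))
        where
        ne : s ≢ v
        ne refl with trans (sym e) (closeAt-self s)
        ... | ()
    outAt-view .(fromℕ n) new with lookup ot (fromℕ n) in e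
    ... | none = refl
    ... | semi = refl
    ... | arc b = Irr.⊥-elim (fromℕ≮ (WellFormed.leftLess w (fromℕ n) b e))
      where
      fromℕ≮ : fromℕ n <ᶠ b → ⊥
      fromℕ≮ q = <-irrefl refl (≤-trans (subst (_< toℕ b) (toℕ-fromℕ n) q) (≤-pred (toℕ<n b)))


module Nestings where

  open import Data.Nat using (ℕ; suc; _+_; _≤_; _<_; z≤n)
  open import Data.Nat.Properties using (≤-trans; n≤1+n; +-identityʳ; +-comm; <⇒≤)
  import Data.Nat.Properties as ℕ
  open import Data.Fin using (Fin; suc; toℕ) renaming (_<_ to _<ᶠ_)
  open import Data.Fin.Properties using (toℕ<n; <-trans)
  open import Data.List using (List; []; _∷_; map; _++_; reverse; length; [_]; fromMaybe)
  open import Data.List.Properties using (unfold-reverse; ++-assoc)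
  open import Data.List.Relation.Unary.All as All using (All; []; _∷_)
  open import Data.List.Relation.Unary.All.Properties using (++⁺; ++⁻)
  open import Data.List.Relation.Unary.AllPairs using (AllPairs; []; _∷_)
  import Data.List.Relation.Unary.AllPairs.Properties as AllPairs
  open import Data.List.Relation.Unary.Linked using (Linked)
  open import Data.List.Relation.Unary.Linked.Properties using (Linked⇒AllPairs; AllPairs⇒Linked)
  open import Data.Maybe using (Maybe; just; nothing)
  open import Data.Product using (Σ; _×_; _,_; proj₁; proj₂)
  open import Data.Unit using (⊤; tt)
  open import Relation.Nullary using (¬_)
  open import Relation.Nullary.Decidable using (recompute)
  open import Relation.Binary.PropositionalEquality hiding ([_])
  open import Defs
  open Extension

  Ascending : ∀ {n} → List (Fin n) → Set
  Ascending = AllPairs _<ᶠ_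

  linked⇒ascending : ∀ {n} {xs : List (Fin n)} → Linked _<ᶠ_ xs → Ascending xs
  linked⇒ascending = Linked⇒AllPairs <-trans

  module _ {n : ℕ} where
    ascending-∷ʳ⁻ : ∀ W {b : Fin n} → Ascending (W ++ [ b ]) → Ascending W × All (_<ᶠ b) W
    ascending-∷ʳ⁻ []      _           = [] , []
    ascending-∷ʳ⁻ (x ∷ W) (x< ∷ asc) with ascending-∷ʳ⁻ W asc | ++⁻ W x<
    ... | ascW , W<b | x<W , (x<b ∷ []) = (x<W ∷ ascW) , (x<b ∷ W<b)

    ascending-∷ʳ⁺ : ∀ W {b : Fin n} → Ascending W → All (_<ᶠ b) W → Ascending (W ++ [ b ])
    ascending-∷ʳ⁺ W ascW W<b = AllPairs.++⁺ ascW ([] ∷ []) (All.map (_∷ []) W<b)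

    nestingVertices : List (Fin n × Fin n) → List (Fin n) → List (Fin n)
    nestingVertices ps M = map proj₁ ps ++ (M ++ reverse (map proj₂ ps))

    nestingVertices-∷ : ∀ a b ps M → nestingVertices ((a , b) ∷ ps) M ≡ a ∷ (nestingVertices ps M ++ [ b ])
    nestingVertices-∷ a b ps M = cong (a ∷_) (begin
        map proj₁ ps ++ (M ++ reverse (b ∷ map proj₂ ps))
      ≡⟨ cong (λ z → map proj₁ ps ++ (M ++ z)) (unfold-reverse b (map proj₂ ps)) ⟩
        map proj₁ ps ++ (M ++ (reverse (map proj₂ ps) ++ [ b ]))
      ≡⟨ cong (map proj₁ ps ++_) (sym (++-assoc M _ [ b ])) ⟩
        map proj₁ ps ++ ((M ++ reverse (map proj₂ ps)) ++ [ b ])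
      ≡⟨ sym (++-assoc (map proj₁ ps) _ [ b ]) ⟩
        nestingVertices ps M ++ [ b ] ∎)
      where open ≡-Reasoning

  arc-< : ∀ {n} (π : Diagram n) {a b} → IsArc π (a , b) → toℕ a < toℕ b
  arc-< (diagram ot w) {a} {b} eq = recompute (toℕ a ℕ.<? toℕ b) (WellFormed.leftLess w a b eq)

  module _ {n : ℕ} (π : Diagram n) where
    -- An enhanced m-nesting all of whose vertices lie in [lo, hi), peeled from the outermost arc.
    data NestingIn (lo hi : ℕ) : ℕ → Set where
      empty  : NestingIn lo hi 0
      point  : (f : Fin n) → IsFixed π f → lo ≤ toℕ f → toℕ f < hi → NestingIn lo hi 1
      around : ∀ {m} (a b : Fin n) → IsArc π (a , b) → lo ≤ toℕ a → toℕ b < hi →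
               NestingIn (suc (toℕ a)) (toℕ b) m → NestingIn lo hi (suc m)

    FixedIfAny : Maybe (Fin n) → Set
    FixedIfAny nothing = ⊤
    FixedIfAny (just f) = IsFixed π f

    InRange : ℕ → ℕ → Fin n → Set
    InRange lo hi v = lo ≤ toℕ v × toℕ v < hi

    fromNestingList : ∀ ps M lo hi → All (IsArc π) ps → FixedIfAny M →
                      Ascending (nestingVertices ps (fromMaybe M)) → All (InRange lo hi) (nestingVertices ps (fromMaybe M)) →
                      NestingIn lo hi (length ps + length (fromMaybe M))
    fromNestingList [] nothing lo hi _ _ _ _ = empty
    fromNestingList [] (just f) lo hi _ fx _ ((p , q) ∷ []) = point f fx p q
    fromNestingList ((a , b) ∷ ps) M lo hi (ar ∷ ars) mk inc bnd
      rewrite nestingVertices-∷ a b ps (fromMaybe M) with inc | bnd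
    ... | aW ∷ iW | (la , _) ∷ bW
      with ascending-∷ʳ⁻ (nestingVertices ps (fromMaybe M)) iW | ++⁻ (nestingVertices ps (fromMaybe M)) aW
         | ++⁻ (nestingVertices ps (fromMaybe M)) bW
    ...   | iW' , bW' | aW' , _ | _ , ((_ , bh) ∷ []) =
      around a b ar la bh (fromNestingList ps M (suc (toℕ a)) (toℕ b) ars mk iW' (All.zip (aW' , bW')))

    record NestingList (lo hi m : ℕ) : Set where
      constructor nestingList
      field
        arcList    : List (Fin n × Fin n)
        centre     : Maybe (Fin n)
        areArcs    : All (IsArc π) arcList
        centre-fix : FixedIfAny centre
        ascending  : Ascending (nestingVertices arcList (fromMaybe centre))
        inRange    : All (InRange lo hi) (nestingVertices arcList (fromMaybe centre))
        size       : length arcList + length (fromMaybe centre) ≡ m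

    toNestingList : ∀ {lo hi m} → NestingIn lo hi m → NestingList lo hi m
    toNestingList empty = nestingList [] nothing [] tt [] [] refl
    toNestingList (point f fx p q) = nestingList [] (just f) [] fx ([] ∷ []) ((p , q) ∷ []) refl
    toNestingList {lo} {hi} (around a b ar la bh inner) with toNestingList inner
    ... | nestingList ps M ars mk inc bnd len =
      nestingList ((a , b) ∷ ps) M (ar ∷ ars) mk
         (subst Ascending (sym (nestingVertices-∷ a b ps (fromMaybe M)))
            (++⁺ (All.map proj₁ bnd) (ab ∷ []) ∷ ascending-∷ʳ⁺ (nestingVertices ps (fromMaybe M)) inc (All.map proj₂ bnd)))
         (subst (All (InRange lo hi)) (sym (nestingVertices-∷ a b ps (fromMaybe M)))
            ((la , ℕ.<-trans ab bh) ∷ ++⁺ (All.map (λ { (p , q) → ≤-trans la (≤-trans (n≤1+n _) p) , ℕ.<-trans q bh }) bnd)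
                                               ((≤-trans la (<⇒≤ ab) , bh) ∷ [])))
         (cong suc len)
      where
      ab : toℕ a < toℕ b
      ab = arc-< π ar

    HasNesting : ℕ → ℕ → Set
    HasNesting lo m = NestingIn lo n m

    inRange-below-n : ∀ {lo} (xs : List (Fin n)) → All (λ v → lo ≤ toℕ v) xs → All (InRange lo n) xs
    inRange-below-n [] [] = []
    inRange-below-n (x ∷ xs) (p ∷ ps) = (p , toℕ<n x) ∷ inRange-below-n xs ps

    enhancedNesting⇒HasNesting : ∀ {m lo} (e : EnhancedNesting π m) → All (λ v → lo ≤ toℕ v) (vertices π e) →
                                 HasNesting lo m
    enhancedNesting⇒HasNesting {lo = lo} (nesting ps refl ars l) a =
      subst (NestingIn lo n) (+-identityʳ _) (fromNestingList ps nothing lo n ars tt (linked⇒ascending l) (inRange-below-n _ a))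
    enhancedNesting⇒HasNesting {lo = lo} (enhanced ps f refl ars fx l) a =
      subst (NestingIn lo n) (+-comm _ 1) (fromNestingList ps (just f) lo n ars fx (linked⇒ascending l) (inRange-below-n _ a))

    HasNesting⇒enhancedNesting : ∀ {m lo} → HasNesting lo m →
                                 Σ (EnhancedNesting π m) (λ e → All (λ v → lo ≤ toℕ v) (vertices π e))
    HasNesting⇒enhancedNesting h with toNestingList h
    ... | nestingList ps nothing ars mk inc bnd len =
      nesting ps (trans (sym (+-identityʳ _)) len) ars (AllPairs⇒Linked inc) , All.map proj₁ bnd
    ... | nestingList ps (just f) ars mk inc bnd len =
      enhanced ps f (trans (+-comm 1 _) len) ars mk (AllPairs⇒Linked inc) , All.map proj₁ bnd

    inPiTilde⇒ : ∀ k → InPiTilde k π → ¬ HasNesting 0 (suc k) × (∀ s → IsSemi π s → ¬ HasNesting (suc (toℕ s)) k)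
    inPiTilde⇒ k (noNesting , noFuture) =
      (λ h → noNesting (proj₁ (HasNesting⇒enhancedNesting h))) ,
      (λ s semi-s h → let (e , s<e) = HasNesting⇒enhancedNesting h in noFuture (e , s , semi-s , s<e))

    inPiTilde⇐ : ∀ k → ¬ HasNesting 0 (suc k) → (∀ s → IsSemi π s → ¬ HasNesting (suc (toℕ s)) k) → InPiTilde k π
    inPiTilde⇐ k noNesting noFuture =
      (λ e → noNesting (enhancedNesting⇒HasNesting e (All.tabulate (λ _ → z≤n)))) ,
      (λ { (e , s , semi-s , s<e) → noFuture s semi-s (enhancedNesting⇒HasNesting e s<e) })


  NestingIn-widen-hi : ∀ {n} {π : Diagram n} {lo hi hi' m} → hi ≤ hi' → NestingIn π lo hi m → NestingIn π lo hi' m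
  NestingIn-widen-hi h empty = empty
  NestingIn-widen-hi h (point f fx p q) = point f fx p (≤-trans q h)
  NestingIn-widen-hi h (around a b ar p q inner) = around a b ar p (≤-trans q h) inner

  NestingIn-widen-lo : ∀ {n} {π : Diagram n} {lo lo' hi m} → lo ≤ lo' → NestingIn π lo' hi m → NestingIn π lo hi m
  NestingIn-widen-lo h empty = empty
  NestingIn-widen-lo h (point f fx p q) = point f fx (≤-trans h p) q
  NestingIn-widen-lo h (around a b ar p q inner) = around a b ar (≤-trans h p) q inner


module Depth where

  open import Data.Nat using (ℕ; zero; suc; _+_; _≤_; _<_; _⊔_; _≤ᵇ_; z≤n; s≤s)
  open import Data.Nat.Properties
  open import Data.Fin using (Fin; zero; suc; toℕ; inject₁; fromℕ)
  open import Data.Fin.Properties using (toℕ<n; toℕ-inject₁; toℕ-fromℕ; inject₁-injective; fromℕ≢inject₁)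
  open import Data.Maybe using (Maybe; just; nothing)
  open import Data.Bool using (Bool; true; false; if_then_else_)
  open import Data.Product using (_×_; _,_; proj₁; proj₂)
  open import Data.Sum using (_⊎_; inj₁; inj₂)
  open import Data.Empty using (⊥-elim)
  open import Relation.Nullary using (yes; no)
  open import Relation.Binary.PropositionalEquality
  open import Defs
  open Extension
  open Nestings
  open BoolFacts using (≤ᵇ-true; ≤ᵇ-false)

  arc≢semi : ∀ {n} {x : Fin n} → arc x ≢ semi
  arc≢semi ()

  none≢semi : ∀ {n} → none {n} ≢ semi
  none≢semi ()

  module ExtensionNestings {n : ℕ} (π : Diagram n) (o : Bool) (c : Maybe (Fin n)) (pr : ClosesSemi π c) where
    π' : Diagram (suc n)
    π' = extend π o c

    last : Fin (suc n)
    last = fromℕ n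

    outAt-old : ∀ v → outAt π' (inject₁ v) ≡ (if closeAt c v then arc last else liftOut (outAt π v))
    outAt-old v = outAt-extend-inject₁ π o c v

    outAt-last : outAt π' last ≡ (if o then semi else none)
    outAt-last = outAt-extend-fromℕ π o c

    last-not-arc : ∀ {b} → outAt π' last ≢ arc b
    last-not-arc eq = open-or-none≢arc o (trans (sym outAt-last) eq)

    closeAt-false : ∀ v → outAt π v ≢ semi → closeAt c v ≡ false
    closeAt-false v ns with closeAt c v in e
    ... | true = ⊥-elim (ns (pr v (closeAt-true e)))
    ... | false = refl

    arc-old⁻ : ∀ a' b' → outAt π' (inject₁ a') ≡ arc (inject₁ b') → outAt π a' ≡ arc b'
    arc-old⁻ a' b' eq with closeAt c a' | outAt-old a'
    ... | true | e = ⊥-elim (fromℕ≢inject₁ (arc-injective (trans (sym e) eq)))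
    ... | false | e with liftOut-arc (outAt π a') (trans (sym e) eq)
    ...   | b'' , e2 , e3 rewrite inject₁-injective e3 = e2

    arc-old⁺ : ∀ a' b' → outAt π a' ≡ arc b' → outAt π' (inject₁ a') ≡ arc (inject₁ b')
    arc-old⁺ a' b' eq rewrite outAt-old a' | closeAt-false a' (λ e → arc≢semi (trans (sym eq) e)) | eq = refl

    arc-new⁻ : ∀ a' → outAt π' (inject₁ a') ≡ arc last → c ≡ just a'
    arc-new⁻ a' eq with closeAt c a' in e1 | outAt-old a'
    ... | true | _ = closeAt-true e1
    ... | false | e with liftOut-arc (outAt π a') (trans (sym e) eq)
    ...   | b'' , _ , e3 = ⊥-elim (fromℕ≢inject₁ e3)

    fixed⁻ : ∀ v → IsFixed π' (inject₁ v) → IsFixed π v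
    fixed⁻ v (isNone , noArcIn) = isNone′ , noArcIn′
      where
      isNone′ : outAt π v ≡ none
      isNone′ with closeAt c v | outAt-old v
      ... | true  | e with trans (sym e) isNone
      ...   | ()
      isNone′ | false | e = liftOut-none (outAt π v) (trans (sym e) isNone)
        where liftOut-none : ∀ x → liftOut x ≡ none → x ≡ none
              liftOut-none none _ = refl
      noArcIn′ : ∀ a → outAt π a ≢ arc v
      noArcIn′ a eq = noArcIn (inject₁ a) (arc-old⁺ a v eq)

    fixed⁺ : ∀ v → IsFixed π v → IsFixed π' (inject₁ v)
    fixed⁺ v (isNone , noArcIn) = isNone′ , noArcIn′
      where
      isNone′ : outAt π' (inject₁ v) ≡ none
      isNone′ rewrite outAt-old v | closeAt-false v (λ e → none≢semi (trans (sym isNone) e)) | isNone = refl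
      noArcIn′ : ∀ a → outAt π' a ≢ arc (inject₁ v)
      noArcIn′ a eq with view a
      noArcIn′ .(fromℕ n) eq | new = last-not-arc eq
      noArcIn′ .(inject₁ a') eq | old a' with closeAt c a' | outAt-old a'
      ... | true | e = fromℕ≢inject₁ (arc-injective (trans (sym e) eq))
      ... | false | e with liftOut-arc (outAt π a') (trans (sym e) eq)
      ...   | b'' , e2 , e3 rewrite inject₁-injective e3 = noArcIn a' e2

    restrictNesting : ∀ {lo hi m} → hi ≤ n → NestingIn π' lo hi m → NestingIn π lo hi m
    restrictNesting hn empty = empty
    restrictNesting {lo} {hi} hn (point f fx p q) with view f
    ... | old v = point v (fixed⁻ v fx) (subst (lo ≤_) (toℕ-inject₁ v) p) (subst (_< hi) (toℕ-inject₁ v) q)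
    ... | new = ⊥-elim (<-irrefl refl (≤-trans (subst (_< hi) (toℕ-fromℕ n) q) hn))
    restrictNesting {lo} {hi} hn (around a b ar p q inner) with view b
    ... | new = ⊥-elim (<-irrefl refl (≤-trans (subst (_< hi) (toℕ-fromℕ n) q) hn))
    ... | old b' with view a
    ...   | new = ⊥-elim (last-not-arc ar)
    ...   | old a' = around a' b' (arc-old⁻ a' b' ar) (subst (lo ≤_) (toℕ-inject₁ a') p) (subst (_< hi) (toℕ-inject₁ b') q)
                       (subst₂ (λ x y → NestingIn π (suc x) y _) (toℕ-inject₁ a') (toℕ-inject₁ b')
                          (restrictNesting (subst (_≤ n) (sym (toℕ-inject₁ b')) (<⇒≤ (toℕ<n b'))) inner))

    data NestingOfExtension (lo m : ℕ) : Set where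
      avoidsLast : HasNesting π lo m → NestingOfExtension lo m
      newPoint : m ≡ 1 → o ≡ false → c ≡ nothing → lo ≤ n → NestingOfExtension lo m
      newArc : ∀ s m' → c ≡ just s → lo ≤ toℕ s → m ≡ suc m' → HasNesting π (suc (toℕ s)) m' → NestingOfExtension lo m

    classifyNesting : ∀ {lo m} → HasNesting π' lo m → NestingOfExtension lo m
    classifyNesting empty = avoidsLast empty
    classifyNesting {lo} (point f fx p q) with view f
    ... | old v = avoidsLast (point v (fixed⁻ v fx) (subst (lo ≤_) (toℕ-inject₁ v) p) (toℕ<n v))
    ... | new = newPoint refl o≡f c≡n (subst (lo ≤_) (toℕ-fromℕ n) p)
      where
      o≡f : o ≡ false
      o≡f = opens-none o (trans (sym outAt-last) (proj₁ fx))
        where opens-none : ∀ o → _≡_ {A = Out (suc n)} (if o then semi else none) none → o ≡ false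
              opens-none false _ = refl
      c≡n : c ≡ nothing
      c≡n = closes-nothing c refl
        where
        closes-nothing : (c′ : Maybe (Fin n)) → c ≡ c′ → c′ ≡ nothing
        closes-nothing nothing  _  = refl
        closes-nothing (just s) ec = ⊥-elim (proj₂ fx (inject₁ s) (trans (outAt-old s)
          (cong (λ z → if z then arc last else liftOut (outAt π s)) (trans (cong (λ z → closeAt z s) ec) (closeAt-self s)))))
    classifyNesting {lo} (around a b ar p q inner) with view b
    ... | old b' with view a
    ...   | new = ⊥-elim (last-not-arc ar)
    ...   | old a' = avoidsLast (around a' b' (arc-old⁻ a' b' ar) (subst (lo ≤_) (toℕ-inject₁ a') p) (toℕ<n b')
                       (subst₂ (λ x y → NestingIn π (suc x) y _) (toℕ-inject₁ a') (toℕ-inject₁ b')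
                          (restrictNesting (subst (_≤ n) (sym (toℕ-inject₁ b')) (<⇒≤ (toℕ<n b'))) inner)))
    classifyNesting {lo} (around a b ar p q inner) | new with view a
    ...   | new = ⊥-elim (last-not-arc ar)
    ...   | old a' = newArc a' _ (arc-new⁻ a' ar) (subst (lo ≤_) (toℕ-inject₁ a') p) refl
                       (subst₂ (λ x y → NestingIn π (suc x) y _) (toℕ-inject₁ a') (toℕ-fromℕ n)
                          (restrictNesting (subst (_≤ n) (sym (toℕ-fromℕ n)) ≤-refl) inner))

    liftNesting : ∀ {lo hi m} → NestingIn π lo hi m → NestingIn π' lo hi m
    liftNesting empty = empty
    liftNesting {lo} {hi} (point v fx p q) =
      point (inject₁ v) (fixed⁺ v fx) (subst (lo ≤_) (sym (toℕ-inject₁ v)) p) (subst (_< hi) (sym (toℕ-inject₁ v)) q)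
    liftNesting {lo} {hi} (around a b ar p q inner) =
      around (inject₁ a) (inject₁ b) (arc-old⁺ a b ar) (subst (lo ≤_) (sym (toℕ-inject₁ a)) p)
        (subst (_< hi) (sym (toℕ-inject₁ b)) q)
        (subst₂ (λ x y → NestingIn π' (suc x) y _) (sym (toℕ-inject₁ a)) (sym (toℕ-inject₁ b)) (liftNesting inner))

    newPointNesting : ∀ {lo} → o ≡ false → c ≡ nothing → lo ≤ n → HasNesting π' lo 1
    newPointNesting {lo} refl refl p =
      point last (outAt-last , noArcIn) (subst (lo ≤_) (sym (toℕ-fromℕ n)) p) (subst (_< suc n) (sym (toℕ-fromℕ n)) ≤-refl)
      where
      noArcIn : ∀ a → outAt π' a ≢ arc last
      noArcIn a eq with view a
      noArcIn .(fromℕ n) eq | new = last-not-arc eq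
      noArcIn .(inject₁ a') eq | old a' with arc-new⁻ a' eq
      ... | ()

    newArcNesting : ∀ {lo} s m' → c ≡ just s → lo ≤ toℕ s → HasNesting π (suc (toℕ s)) m' → HasNesting π' lo (suc m')
    newArcNesting {lo} s m' refl p h =
      around (inject₁ s) last theNewArc (subst (lo ≤_) (sym (toℕ-inject₁ s)) p) (subst (_< suc n) (sym (toℕ-fromℕ n)) ≤-refl)
        (subst₂ (λ x y → NestingIn π' (suc x) y m') (sym (toℕ-inject₁ s)) (sym (toℕ-fromℕ n)) (liftNesting h))
      where
      theNewArc : outAt π' (inject₁ s) ≡ arc last
      theNewArc rewrite outAt-old s | closeAt-self s = refl

  -- depth π lo is the size of a largest enhanced nesting of π with all vertices ≥ lo (depthSpec),
  -- computed by peeling off the last vertex; a semi-arc (s,*) has enhanced nesting index depth π (s+1).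
  mutual
    depth : ∀ {n} → Diagram n → ℕ → ℕ
    depth {zero} π lo = 0
    depth {suc n} π' lo = depthStep (restrict π') (lastOpens π') (lastCloses π') lo

    depthStep : ∀ {n} → Diagram n → Bool → Maybe (Fin n) → ℕ → ℕ
    depthStep {n} π o nothing lo = if o then depth π lo else (if lo ≤ᵇ n then depth π lo ⊔ 1 else depth π lo)
    depthStep {n} π o (just s) lo = if lo ≤ᵇ toℕ s then depth π lo ⊔ suc (depth π (suc (toℕ s))) else depth π lo

  depth-extend : ∀ {n} (π : Diagram n) o c → ClosesSemi π c → ∀ lo → depth (extend π o c) lo ≡ depthStep π o c lo
  depth-extend π o c pr lo rewrite restrict-extend π o c pr | lastOpens-extend π o c | lastCloses-extend π o c = refl

  depth≤depthStep : ∀ {n} (π : Diagram n) o c lo → depth π lo ≤ depthStep π o c lo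
  depth≤depthStep {n} π true nothing lo = ≤-refl
  depth≤depthStep {n} π false nothing lo with lo ≤ᵇ n
  ... | true = m≤m⊔n _ _
  ... | false = ≤-refl
  depth≤depthStep {n} π o (just s) lo with lo ≤ᵇ toℕ s
  ... | true = m≤m⊔n _ _
  ... | false = ≤-refl

  ≤⊔⇒≤⊎≤ : ∀ {m} x y → m ≤ x ⊔ y → m ≤ x ⊎ m ≤ y
  ≤⊔⇒≤⊎≤ {m} x y p with ⊔-sel x y
  ... | inj₁ e = inj₁ (subst (m ≤_) e p)
  ... | inj₂ e = inj₂ (subst (m ≤_) e p)

  DepthSpec : ∀ {n} → Diagram n → Set
  DepthSpec π = ∀ lo m → (HasNesting π lo m → m ≤ depth π lo) × (m ≤ depth π lo → HasNesting π lo m)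

  hasNesting⇒≤depthStep : ∀ {n} (π : Diagram n) o c (pr : ClosesSemi π c) → DepthSpec π →
                          ∀ lo m → HasNesting (extend π o c) lo m → m ≤ depthStep π o c lo
  hasNesting⇒≤depthStep {n} π o c pr ih lo m h with ExtensionNestings.classifyNesting π o c pr h
  ... | ExtensionNestings.avoidsLast h' = ≤-trans (proj₁ (ih lo m) h') (depth≤depthStep π o c lo)
  ... | ExtensionNestings.newPoint refl refl refl p rewrite ≤ᵇ-true p = m≤n⊔m (depth π lo) 1
  ... | ExtensionNestings.newArc s m' refl p refl h' rewrite ≤ᵇ-true p =
    ≤-trans (s≤s (proj₁ (ih (suc (toℕ s)) m') h')) (m≤n⊔m _ _)

  ≤depth⇒hasNesting-extend : ∀ {n} (π : Diagram n) o c (pr : ClosesSemi π c) → DepthSpec π →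
                             ∀ lo m → m ≤ depth π lo → HasNesting (extend π o c) lo m
  ≤depth⇒hasNesting-extend {n} π o c pr ih lo m p =
    ExtensionNestings.liftNesting π o c pr (NestingIn-widen-hi (n≤1+n n) (proj₂ (ih lo m) p))

  ≤depthStep⇒hasNesting : ∀ {n} (π : Diagram n) o c (pr : ClosesSemi π c) → DepthSpec π →
                          ∀ lo m → m ≤ depthStep π o c lo → HasNesting (extend π o c) lo m
  ≤depthStep⇒hasNesting {n} π true nothing pr ih lo m p = ≤depth⇒hasNesting-extend π true nothing pr ih lo m p
  ≤depthStep⇒hasNesting {n} π false nothing pr ih lo m p with lo ≤? n
  ... | no q rewrite ≤ᵇ-false q = ≤depth⇒hasNesting-extend π false nothing pr ih lo m p
  ... | yes q rewrite ≤ᵇ-true q with ≤⊔⇒≤⊎≤ (depth π lo) 1 p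
  ...   | inj₁ p' = ≤depth⇒hasNesting-extend π false nothing pr ih lo m p'
  ...   | inj₂ p' = viaNewPoint m p'
    where viaNewPoint : ∀ m → m ≤ 1 → HasNesting (extend π false nothing) lo m
          viaNewPoint zero          _ = empty
          viaNewPoint (suc zero)    _ = ExtensionNestings.newPointNesting π false nothing pr refl refl q
          viaNewPoint (suc (suc m)) (s≤s ())
  ≤depthStep⇒hasNesting {n} π o (just s) pr ih lo m p with lo ≤? toℕ s
  ... | no q rewrite ≤ᵇ-false q = ≤depth⇒hasNesting-extend π o (just s) pr ih lo m p
  ... | yes q rewrite ≤ᵇ-true q with ≤⊔⇒≤⊎≤ (depth π lo) _ p
  ...   | inj₁ p' = ≤depth⇒hasNesting-extend π o (just s) pr ih lo m p'
  ...   | inj₂ p' = viaNewArc m p'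
    where viaNewArc : ∀ m → m ≤ suc (depth π (suc (toℕ s))) → HasNesting (extend π o (just s)) lo m
          viaNewArc zero    _       = empty
          viaNewArc (suc m) (s≤s r) =
            ExtensionNestings.newArcNesting π o (just s) pr s m refl q (proj₂ (ih (suc (toℕ s)) m) r)

  depthSpec : ∀ {n} (π : Diagram n) → DepthSpec π
  depthSpec {zero} π lo m = bound , build
    where bound : HasNesting π lo m → m ≤ 0
          bound empty = z≤n
          build : m ≤ 0 → HasNesting π lo m
          build z≤n = empty
  depthSpec {suc n} π' lo m =
    subst (λ z → (HasNesting z lo m → m ≤ depth π' lo) × (m ≤ depth π' lo → HasNesting z lo m)) (extend-restrict π')
      (hasNesting⇒≤depthStep π₀ (lastOpens π') (lastCloses π') (closesSemi-lastCloses π') (depthSpec π₀) lo m ,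
       ≤depthStep⇒hasNesting π₀ (lastOpens π') (lastCloses π') (closesSemi-lastCloses π') (depthSpec π₀) lo m)
    where π₀ : Diagram n
          π₀ = restrict π'

  hasNesting⇒≤depth : ∀ {n} (π : Diagram n) {lo m} → HasNesting π lo m → m ≤ depth π lo
  hasNesting⇒≤depth π {lo} {m} = proj₁ (depthSpec π lo m)

  ≤depth⇒hasNesting : ∀ {n} (π : Diagram n) {lo m} → m ≤ depth π lo → HasNesting π lo m
  ≤depth⇒hasNesting π {lo} {m} = proj₂ (depthSpec π lo m)

  depth-antitone : ∀ {n} (π : Diagram n) {lo lo′} → lo ≤ lo′ → depth π lo′ ≤ depth π lo
  depth-antitone π lo≤lo′ = hasNesting⇒≤depth π (NestingIn-widen-lo lo≤lo′ (≤depth⇒hasNesting π ≤-refl))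


module FinLists where

  open import Data.Nat using (ℕ; zero; suc; _<_)
  import Data.Nat.Properties as ℕ
  open import Data.Fin using (Fin; zero; suc; toℕ; inject₁; fromℕ) renaming (_<_ to _<ᶠ_)
  open import Data.Fin.Properties using (toℕ<n; toℕ-inject₁; toℕ-fromℕ)
  open import Data.List using (List; []; _∷_; map; _++_; length; take; drop; filterᵇ) renaming (lookup to lookupL)
  open import Data.List.Properties using (filter-++; filter-all; filter-accept; filter-reject; ++-identityʳ)
  open import Data.List.Relation.Unary.All as All using (All; []; _∷_)
  open import Data.List.Relation.Unary.All.Properties using (++⁺; map⁺)
  open import Data.List.Relation.Unary.AllPairs as AllPairs using ([]; _∷_)
  import Data.List.Relation.Unary.AllPairs.Properties as AllPairs⁺
  open import Data.Maybe using (just)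
  open import Data.Bool using (Bool; true; false; not; _∧_; T)
  open import Data.Product using (Σ; _,_)
  open import Data.Sum using (inj₁; inj₂)
  open import Data.Empty using (⊥-elim)
  open import Function using (_∘_)
  open import Relation.Nullary.Decidable using (T?)
  open import Relation.Binary.PropositionalEquality
  open Enumeration using (joinIndex; lookup-joinIndex₁; lookup-joinIndex₂)
  open Extension using (view; old; new; closeAt; closeAt-self; closeAt-≢)
  open Nestings using (Ascending; ascending-∷ʳ⁺)
  open Profiles using (All-lookup)
  open BoolFacts using (≡true⇒T)

  filterᵇ-++ : ∀ {A : Set} (q : A → Bool) xs ys → filterᵇ q (xs ++ ys) ≡ filterᵇ q xs ++ filterᵇ q ys
  filterᵇ-++ q = filter-++ (T? ∘ q)

  filterᵇ-map : ∀ {A B : Set} (f : A → B) (q : B → Bool) xs → filterᵇ q (map f xs) ≡ map f (filterᵇ (q ∘ f) xs)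
  filterᵇ-map f q []       = refl
  filterᵇ-map f q (x ∷ xs) with q (f x)
  ... | true  = cong (f x ∷_) (filterᵇ-map f q xs)
  ... | false = filterᵇ-map f q xs

  mapIndex : ∀ {A B : Set} (f : A → B) xs → Fin (length xs) → Fin (length (map f xs))
  mapIndex f (x ∷ xs) zero    = zero
  mapIndex f (x ∷ xs) (suc r) = suc (mapIndex f xs r)

  unmapIndex : ∀ {A B : Set} (f : A → B) xs → Fin (length (map f xs)) → Fin (length xs)
  unmapIndex f (x ∷ xs) zero    = zero
  unmapIndex f (x ∷ xs) (suc r) = suc (unmapIndex f xs r)

  unmapIndex-mapIndex : ∀ {A B : Set} (f : A → B) xs r → unmapIndex f xs (mapIndex f xs r) ≡ r
  unmapIndex-mapIndex f (x ∷ xs) zero    = refl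
  unmapIndex-mapIndex f (x ∷ xs) (suc r) = cong suc (unmapIndex-mapIndex f xs r)

  mapIndex-unmapIndex : ∀ {A B : Set} (f : A → B) xs r → mapIndex f xs (unmapIndex f xs r) ≡ r
  mapIndex-unmapIndex f (x ∷ xs) zero    = refl
  mapIndex-unmapIndex f (x ∷ xs) (suc r) = cong suc (mapIndex-unmapIndex f xs r)

  toℕ-mapIndex : ∀ {A B : Set} (f : A → B) xs r → toℕ (mapIndex f xs r) ≡ toℕ r
  toℕ-mapIndex f (x ∷ xs) zero    = refl
  toℕ-mapIndex f (x ∷ xs) (suc r) = cong suc (toℕ-mapIndex f xs r)

  lookup-map-unmapIndex : ∀ {A B : Set} (f : A → B) xs r → lookupL (map f xs) r ≡ f (lookupL xs (unmapIndex f xs r))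
  lookup-map-unmapIndex f (x ∷ xs) zero    = refl
  lookup-map-unmapIndex f (x ∷ xs) (suc r) = lookup-map-unmapIndex f xs r

  lookup-map-mapIndex : ∀ {A B : Set} (f : A → B) xs r → lookupL (map f xs) (mapIndex f xs r) ≡ f (lookupL xs r)
  lookup-map-mapIndex f (x ∷ xs) zero    = refl
  lookup-map-mapIndex f (x ∷ xs) (suc r) = lookup-map-mapIndex f xs r

  lastIf : ∀ {n} → Bool → List (Fin (suc n))
  lastIf {n} true  = fromℕ n ∷ []
  lastIf     false = []

  -- Recursion on the last vertex (rather than filtering allFin) matches extend.
  finsWhere : ∀ {n} → (Fin n → Bool) → List (Fin n)
  finsWhere {zero}  p = []
  finsWhere {suc n} p = map inject₁ (finsWhere (p ∘ inject₁)) ++ lastIf (p (fromℕ n))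

  finsWhere-cong : ∀ {n} (p q : Fin n → Bool) → (∀ v → p v ≡ q v) → finsWhere p ≡ finsWhere q
  finsWhere-cong {zero}  p q p≗q = refl
  finsWhere-cong {suc n} p q p≗q
    rewrite finsWhere-cong (p ∘ inject₁) (q ∘ inject₁) (p≗q ∘ inject₁) | p≗q (fromℕ n) = refl

  finsWhere-sound : ∀ {n} (p : Fin n → Bool) → All (λ v → p v ≡ true) (finsWhere p)
  finsWhere-sound {zero}  p = []
  finsWhere-sound {suc n} p = ++⁺ (map⁺ (finsWhere-sound (p ∘ inject₁))) (lastIf-sound (p (fromℕ n)) refl)
    where lastIf-sound : ∀ b → p (fromℕ n) ≡ b → All (λ v → p v ≡ true) (lastIf b)
          lastIf-sound true  e = e ∷ []
          lastIf-sound false e = []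

  ascending-map-inject₁ : ∀ {n} {L : List (Fin n)} → Ascending L → Ascending (map inject₁ L)
  ascending-map-inject₁ =
    AllPairs⁺.map⁺ ∘ AllPairs.map (λ {x} {y} x<y → subst₂ _<_ (sym (toℕ-inject₁ x)) (sym (toℕ-inject₁ y)) x<y)

  finsWhere-ascending : ∀ {n} (p : Fin n → Bool) → Ascending (finsWhere p)
  finsWhere-ascending {zero}  p = []
  finsWhere-ascending {suc n} p with p (fromℕ n)
  ... | false = subst Ascending (sym (++-identityʳ _)) (ascending-map-inject₁ (finsWhere-ascending (p ∘ inject₁)))
  ... | true  = ascending-∷ʳ⁺ _ (ascending-map-inject₁ (finsWhere-ascending (p ∘ inject₁)))
                  (map⁺ (All.tabulate (λ {v} _ → subst₂ _<_ (sym (toℕ-inject₁ v)) (sym (toℕ-fromℕ n)) (toℕ<n v))))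

  finsWhere-complete : ∀ {n} (p : Fin n → Bool) v → p v ≡ true → Σ (Fin (length (finsWhere p))) (λ r → lookupL (finsWhere p) r ≡ v)
  finsWhere-complete {suc n} p v pv with view v
  ... | old v′ with finsWhere-complete (p ∘ inject₁) v′ pv
  ...   | r′ , e = joinIndex (map inject₁ L′) (lastIf (p (fromℕ n))) (inj₁ (mapIndex inject₁ L′ r′)) ,
                   trans (lookup-joinIndex₁ (map inject₁ L′) (lastIf (p (fromℕ n))) _)
                         (trans (lookup-map-mapIndex inject₁ L′ r′) (cong inject₁ e))
    where L′ : List (Fin n)
          L′ = finsWhere (p ∘ inject₁)
  finsWhere-complete {suc n} p v pv | new rewrite pv =
    joinIndex (map inject₁ L′) (fromℕ n ∷ []) (inj₂ zero) , lookup-joinIndex₂ (map inject₁ L′) (fromℕ n ∷ []) zero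
    where L′ : List (Fin n)
          L′ = finsWhere (p ∘ inject₁)

  finsWhere-∧ : ∀ {n} (q p : Fin n → Bool) → finsWhere (λ v → q v ∧ p v) ≡ filterᵇ q (finsWhere p)
  finsWhere-∧ {zero}  q p = refl
  finsWhere-∧ {suc n} q p =
    trans (cong₂ _++_ (trans (cong (map inject₁) (finsWhere-∧ (q ∘ inject₁) (p ∘ inject₁)))
                             (sym (filterᵇ-map inject₁ q (finsWhere (p ∘ inject₁)))))
                      (lastIf-∧ (q (fromℕ n)) (p (fromℕ n)) refl))
          (sym (filterᵇ-++ q (map inject₁ (finsWhere (p ∘ inject₁))) (lastIf (p (fromℕ n)))))
    where lastIf-∧ : ∀ a b → q (fromℕ n) ≡ a → lastIf (a ∧ b) ≡ filterᵇ q (lastIf b)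
          lastIf-∧ true  true  e rewrite e = refl
          lastIf-∧ true  false e = refl
          lastIf-∧ false true  e rewrite e = refl
          lastIf-∧ false false e = refl

  module _ {n : ℕ} where
    ascending-lookup-injective : {L : List (Fin n)} → Ascending L → (r r′ : Fin (length L)) →
                                 lookupL L r ≡ lookupL L r′ → r ≡ r′
    ascending-lookup-injective (x< ∷ asc) zero    zero     e = refl
    ascending-lookup-injective (x< ∷ asc) zero    (suc r′) e = ⊥-elim (ℕ.<-irrefl (cong toℕ e) (All-lookup x< r′))
    ascending-lookup-injective (x< ∷ asc) (suc r) zero     e = ⊥-elim (ℕ.<-irrefl (cong toℕ (sym e)) (All-lookup x< r))
    ascending-lookup-injective (x< ∷ asc) (suc r) (suc r′) e = cong suc (ascending-lookup-injective asc r r′ e)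

    ascending-take-< : {L : List (Fin n)} → Ascending L → (r : Fin (length L)) → All (_<ᶠ lookupL L r) (take (toℕ r) L)
    ascending-take-< (x< ∷ asc) zero    = []
    ascending-take-< (x< ∷ asc) (suc r) = All-lookup x< r ∷ ascending-take-< asc r

    ascending-drop-> : {L : List (Fin n)} → Ascending L → (r : Fin (length L)) → All (lookupL L r <ᶠ_) (drop (suc (toℕ r)) L)
    ascending-drop-> (x< ∷ asc) zero    = x<
    ascending-drop-> (x< ∷ asc) (suc r) = ascending-drop-> asc r

    filterᵇ-not-closeAt : {L : List (Fin n)} → Ascending L → (r : Fin (length L)) →
                          filterᵇ (not ∘ closeAt (just (lookupL L r))) L ≡ take (toℕ r) L ++ drop (suc (toℕ r)) L
    filterᵇ-not-closeAt {x ∷ L} (x< ∷ asc) zero =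
      trans (filter-reject (T? ∘ not ∘ closeAt (just x)) (λ t → subst (λ b → T (not b)) (closeAt-self x) t))
            (filter-all (T? ∘ not ∘ closeAt (just x))
              (All.map (λ x<y → ≡true⇒T (cong not (closeAt-≢ _ _ (λ e → ℕ.<-irrefl (cong toℕ e) x<y)))) x<))
    filterᵇ-not-closeAt {x ∷ L} (x< ∷ asc) (suc r) =
      trans (filter-accept (T? ∘ not ∘ closeAt (just (lookupL L r)))
               (≡true⇒T (cong not (closeAt-≢ (lookupL L r) x (λ e → ℕ.<-irrefl (cong toℕ (sym e)) (All-lookup x< r))))))
            (cong (x ∷_) (filterᵇ-not-closeAt asc r))


module DiagramProfiles where

  open import Data.Nat using (ℕ; zero; suc; _+_; _≤_; _<_; _⊔_; _≤ᵇ_; z≤n; s≤s)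
  open import Data.Nat.Properties
  open import Data.Fin using (Fin; zero; suc; toℕ; inject₁; fromℕ)
  open import Data.Fin.Properties using (toℕ<n; toℕ-inject₁; toℕ-fromℕ)
  open import Data.List using (List; []; _∷_; map; _++_; length; take; drop) renaming (lookup to lookupL)
  open import Data.List.Properties using (map-++; ++-identityʳ; map-cong; map-∘)
  open import Data.List.Relation.Unary.All as All using (All; []; _∷_)
  open import Data.Maybe using (Maybe; just; nothing)
  open import Data.Bool using (Bool; true; false; if_then_else_; not; _∧_)
  open import Data.Product using (_,_)
  open import Data.Empty using (⊥; ⊥-elim)
  open import Function using (_∘_)
  open import Relation.Binary.PropositionalEquality
  import Data.List.Relation.Unary.AllPairs as AllPairs
  import Data.List.Relation.Unary.AllPairs.Properties as AllPairs⁺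
  open import Defs
  open Profiles using (addFixed; addSemi; closeSemi; closeWith; closeWith-map; zeroIf; Decreasing; All-lookup)
  open BoolFacts using (≤ᵇ-true; ≤ᵇ-false)
  open Extension
  open Nestings
  open Depth
  open FinLists

  isSemiAt : ∀ {n} → Diagram n → Fin n → Bool
  isSemiAt π v = isSemi (outAt π v)

  semiArcs : ∀ {n} → Diagram n → List (Fin n)
  semiArcs π = finsWhere (isSemiAt π)

  nestingIndex : ∀ {n} → Diagram n → Fin n → ℕ
  nestingIndex π v = depth π (suc (toℕ v))

  -- The enhanced nesting indices of the semi-arcs, left to right; ℓ(π) = label k (profile π).
  profile : ∀ {n} → Diagram n → List ℕ
  profile π = map (nestingIndex π) (semiArcs π)

  profile-decreasing : ∀ {n} (π : Diagram n) → Decreasing (profile π)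
  profile-decreasing π =
    AllPairs⁺.map⁺ (AllPairs.map (λ x<y → depth-antitone π (s≤s (<⇒≤ x<y))) (finsWhere-ascending (isSemiAt π)))

  depth-≥n : ∀ {n} (π : Diagram n) lo → n ≤ lo → depth π lo ≡ 0
  depth-≥n {n} π lo p with depth π lo in e
  ... | zero = refl
  ... | suc x = ⊥-elim (noNesting (≤depth⇒hasNesting π (subst (1 ≤_) (sym e) (s≤s z≤n))))
    where noNesting : HasNesting π lo 1 → ⊥
          noNesting (point f _ q _)      = <-irrefl refl (<-≤-trans (toℕ<n f) (≤-trans p q))
          noNesting (around a b _ q _ _) = <-irrefl refl (<-≤-trans (toℕ<n a) (≤-trans p q))

  semiArcs-semi : ∀ {n} (π : Diagram n) (r : Fin (length (semiArcs π))) → outAt π (lookupL (semiArcs π) r) ≡ semi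
  semiArcs-semi π r = isSemi-true (All-lookup (finsWhere-sound (isSemiAt π)) r)

  module ProfileOfExtension {n : ℕ} (π : Diagram n) (o : Bool) (c : Maybe (Fin n)) (pr : ClosesSemi π c) where
    π' : Diagram (suc n)
    π' = extend π o c

    isSemiAt-old : ∀ v → isSemiAt π' (inject₁ v) ≡ (if closeAt c v then false else isSemiAt π v)
    isSemiAt-old v rewrite outAt-extend-inject₁ π o c v with closeAt c v
    ... | true = refl
    ... | false = isSemi-liftOut (outAt π v)

    isSemiAt-last : isSemiAt π' (fromℕ n) ≡ o
    isSemiAt-last rewrite outAt-extend-fromℕ π o c = isSemi-opens o
      where isSemi-opens : ∀ o → isSemi {suc n} (if o then semi else none) ≡ o
            isSemi-opens true  = refl
            isSemi-opens false = refl

    semiArcs-extend : semiArcs π' ≡ map inject₁ (finsWhere (λ v → if closeAt c v then false else isSemiAt π v)) ++ lastIf o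
    semiArcs-extend = cong₂ (λ a b → map inject₁ a ++ lastIf b) (finsWhere-cong _ _ isSemiAt-old) isSemiAt-last

    nestingIndex-old : ∀ v → nestingIndex π' (inject₁ v) ≡ depthStep π o c (suc (toℕ v))
    nestingIndex-old v rewrite toℕ-inject₁ v = depth-extend π o c pr (suc (toℕ v))

    nestingIndex-last : nestingIndex π' (fromℕ n) ≡ 0
    nestingIndex-last = depth-≥n π' (suc (toℕ (fromℕ n))) (s≤s (subst (n ≤_) (sym (toℕ-fromℕ n)) ≤-refl))

    map-nestingIndex-lastIf : map (nestingIndex π') (lastIf o) ≡ zeroIf o
    map-nestingIndex-lastIf = map-lastIf o
      where map-lastIf : ∀ o → map (nestingIndex π') (lastIf o) ≡ zeroIf o
            map-lastIf true  = cong (_∷ []) nestingIndex-last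
            map-lastIf false = refl

    profile-extend : ∀ L → finsWhere (λ v → if closeAt c v then false else isSemiAt π v) ≡ L →
                profile π' ≡ map (λ v → depthStep π o c (suc (toℕ v))) L ++ zeroIf o
    profile-extend L eq = begin
        map (nestingIndex π') (semiArcs π')
      ≡⟨ cong (map (nestingIndex π')) (trans semiArcs-extend (cong (λ z → map inject₁ z ++ lastIf o) eq)) ⟩
        map (nestingIndex π') (map inject₁ L ++ lastIf o)
      ≡⟨ map-++ (nestingIndex π') (map inject₁ L) (lastIf o) ⟩
        map (nestingIndex π') (map inject₁ L) ++ map (nestingIndex π') (lastIf o)
      ≡⟨ cong₂ _++_ (trans (sym (map-∘ L)) (map-cong nestingIndex-old L)) map-nestingIndex-lastIf ⟩
        map (λ v → depthStep π o c (suc (toℕ v))) L ++ zeroIf o ∎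
      where open ≡-Reasoning

  profile-addFixed : ∀ {n} (π : Diagram n) → profile (extend π false nothing) ≡ addFixed (profile π)
  profile-addFixed {n} π = begin
      profile (extend π false nothing)
    ≡⟨ ProfileOfExtension.profile-extend π false nothing (λ _ ()) (semiArcs π) refl ⟩
      map (λ v → depthStep π false nothing (suc (toℕ v))) (semiArcs π) ++ []
    ≡⟨ ++-identityʳ _ ⟩
      map (λ v → depthStep π false nothing (suc (toℕ v))) (semiArcs π)
    ≡⟨ map-cong index-after-fixed (semiArcs π) ⟩
      map (λ v → nestingIndex π v ⊔ 1) (semiArcs π)
    ≡⟨ map-∘ (semiArcs π) ⟩
      addFixed (profile π) ∎
    where
    open ≡-Reasoning
    index-after-fixed : ∀ v → depthStep π false nothing (suc (toℕ v)) ≡ nestingIndex π v ⊔ 1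
    index-after-fixed v rewrite ≤ᵇ-true (toℕ<n v) = refl

  profile-addSemi : ∀ {n} (π : Diagram n) → profile (extend π true nothing) ≡ addSemi (profile π)
  profile-addSemi {n} π = ProfileOfExtension.profile-extend π true nothing (λ _ ()) (semiArcs π) refl

  profile-closeSemi : ∀ {n} (π : Diagram n) o (r : Fin (length (semiArcs π))) →
                      profile (extend π o (just (lookupL (semiArcs π) r))) ≡
                      closeSemi (profile π) (mapIndex (nestingIndex π) (semiArcs π) r) o
  profile-closeSemi {n} π o r = begin
      profile (extend π o (just s))
    ≡⟨ ProfileOfExtension.profile-extend π o (just s) closesSemi remaining remaining≡ ⟩
      map index′ remaining ++ zeroIf o
    ≡⟨ sym (closeWith-map d (nestingIndex π) index′ S (toℕ r) o
             (All.map index′-left (ascending-take-< ascending r)) (All.map index′-right (ascending-drop-> ascending r))) ⟩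
      closeWith d (profile π) (toℕ r) o
    ≡⟨ sym (cong₂ (λ d r → closeWith d (profile π) r o) (lookup-map-mapIndex (nestingIndex π) S r)
                                                       (toℕ-mapIndex (nestingIndex π) S r)) ⟩
      closeSemi (profile π) (mapIndex (nestingIndex π) S r) o ∎
    where
    open ≡-Reasoning
    S : List (Fin n)
    S = semiArcs π
    ascending : Ascending S
    ascending = finsWhere-ascending (isSemiAt π)
    s : Fin n
    s = lookupL S r
    d : ℕ
    d = nestingIndex π s
    closesSemi : ClosesSemi π (just s)
    closesSemi _ refl = semiArcs-semi π r
    remaining : List (Fin n)
    remaining = take (toℕ r) S ++ drop (suc (toℕ r)) S
    remaining≡ : finsWhere (λ v → if closeAt (just s) v then false else isSemiAt π v) ≡ remaining
    remaining≡ = trans (finsWhere-cong _ _ (λ v → if-false≡not-∧ (closeAt (just s) v)))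
                       (trans (finsWhere-∧ (not ∘ closeAt (just s)) (isSemiAt π)) (filterᵇ-not-closeAt ascending r))
      where if-false≡not-∧ : ∀ b {x} → (if b then false else x) ≡ (not b ∧ x)
            if-false≡not-∧ true  = refl
            if-false≡not-∧ false = refl
    index′ : Fin n → ℕ
    index′ v = depthStep π o (just s) (suc (toℕ v))
    index′-left : ∀ {v} → toℕ v < toℕ s → index′ v ≡ nestingIndex π v ⊔ suc d
    index′-left v<s rewrite ≤ᵇ-true v<s = refl
    index′-right : ∀ {v} → toℕ s < toℕ v → index′ v ≡ nestingIndex π v
    index′-right {v} s<v rewrite ≤ᵇ-false {suc (toℕ v)} {toℕ s} (<⇒≱ (<-trans s<v (n<1+n _))) = refl


module Decomposition (k : ℕ) (2≤k : 2 ≤ k) where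

  open import Data.Nat using (ℕ; zero; suc; _≤_; _<_; _⊔_; z≤n)
  open import Data.Nat.Properties using (≤-trans; <-irrefl; <-≤-trans; _≤?_; _<?_; ≰⇒>; ≮⇒≥)
  open import Data.Fin using (Fin; zero; suc; toℕ)
  open import Data.Vec using ([])
  open import Data.List using (List; []; _∷_; map; concat; length) renaming (lookup to lookupL)
  open import Data.List.Relation.Unary.All using (All; []; _∷_; all?)
  open import Data.Maybe using (Maybe; just; nothing)
  open import Data.Bool using (Bool; true; false; T)
  open import Data.Bool.Properties using (T-irrelevant)
  open import Data.Product using (Σ; _×_; _,_; proj₁; proj₂)
  open import Data.Unit using (tt)
  open import Data.Empty using (⊥-elim)
  open import Data.Irrelevant using (Irrelevant; [_])
  open import Relation.Nullary using (¬_; yes; no)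
  open import Relation.Nullary.Decidable using (recompute; T?)
  open import Relation.Binary.PropositionalEquality
  open Enumeration
  open Profiles
  open BoolFacts
  open Extension
  open Nestings
  open Depth
  open FinLists
  open DiagramProfiles
  open TreeLevels k using (level; descendants-suc)

  inPiTilde⇒admissible : ∀ {n} (π : Diagram n) → InPiTilde k π → Admissible k (depth π 0) (profile π)
  inPiTilde⇒admissible π ip with inPiTilde⇒ π k ip
  ... | noNesting , noFuture = depth≤k , indices<k (semiArcs π) (finsWhere-sound (isSemiAt π))
    where
    depth≤k : depth π 0 ≤ k
    depth≤k with depth π 0 ≤? k
    ... | yes p = p
    ... | no p  = ⊥-elim (noNesting (≤depth⇒hasNesting π (≰⇒> p)))
    indices<k : ∀ L → All (λ v → isSemiAt π v ≡ true) L → All (_< k) (map (nestingIndex π) L)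
    indices<k []      []         = []
    indices<k (v ∷ L) (sv ∷ sL) = index<k ∷ indices<k L sL
      where index<k : nestingIndex π v < k
            index<k with nestingIndex π v <? k
            ... | yes q = q
            ... | no q  = ⊥-elim (noFuture v (isSemi-true sv) (≤depth⇒hasNesting π (≮⇒≥ q)))

  admissible⇒inPiTilde : ∀ {n} (π : Diagram n) → Admissible k (depth π 0) (profile π) → InPiTilde k π
  admissible⇒inPiTilde π (depth≤k , profile<k) = inPiTilde⇐ π k noNesting noFuture
    where
    noNesting : ¬ HasNesting π 0 (suc k)
    noNesting h = <-irrefl refl (≤-trans (hasNesting⇒≤depth π h) depth≤k)
    noFuture : ∀ s → IsSemi π s → ¬ HasNesting π (suc (toℕ s)) k
    noFuture s semi-s h with finsWhere-complete (isSemiAt π) s (cong isSemi semi-s)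
    ... | pos , e = <-irrefl refl (<-≤-trans index<k (subst (k ≤_) (cong (nestingIndex π) (sym e)) (hasNesting⇒≤depth π h)))
      where index<k : nestingIndex π (lookupL (semiArcs π) pos) < k
            index<k = subst (_< k) (lookup-map-mapIndex (nestingIndex π) (semiArcs π) pos)
                        (All-lookup profile<k (mapIndex (nestingIndex π) (semiArcs π) pos))

  module _ {n : ℕ} (π : Diagram n) where
    private
      S : List (Fin n)
      S = semiArcs π

    closesSemiᵇ : Maybe (Fin n) → Bool
    closesSemiᵇ nothing  = true
    closesSemiᵇ (just s) = isSemiAt π s

    closesSemiᵇ⇒ClosesSemi : ∀ c → T (closesSemiᵇ c) → ClosesSemi π c
    closesSemiᵇ⇒ClosesSemi (just s) p .s refl = isSemi-true (T⇒≡true p)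

    vertexOf : Move k (profile π) → Bool × Maybe (Fin n)
    vertexOf fixed           = false , nothing
    vertexOf opening         = true , nothing
    vertexOf (closing r o _) = o , just (lookupL S (unmapIndex (nestingIndex π) S r))

    closesSemiᵇ-vertexOf : ∀ m → T (closesSemiᵇ (proj₂ (vertexOf m)))
    closesSemiᵇ-vertexOf fixed           = tt
    closesSemiᵇ-vertexOf opening         = tt
    closesSemiᵇ-vertexOf (closing r o v) = ≡true⇒T (All-lookup (finsWhere-sound (isSemiAt π)) (unmapIndex (nestingIndex π) S r))

    extendBy : Move k (profile π) → Diagram (suc n)
    extendBy m = extend π (proj₁ (vertexOf m)) (proj₂ (vertexOf m))

    depthAfter : Move k (profile π) → ℕ
    depthAfter fixed           = depth π 0 ⊔ 1
    depthAfter opening         = depth π 0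
    depthAfter (closing r o v) = depth π 0 ⊔ suc (lookupL (profile π) r)

    profile-extendBy : ∀ m → profile (extendBy m) ≡ afterMove m
    profile-extendBy fixed           = profile-addFixed π
    profile-extendBy opening         = profile-addSemi π
    profile-extendBy (closing r o v) =
      trans (profile-closeSemi π o (unmapIndex (nestingIndex π) S r))
            (cong (λ z → closeSemi (profile π) z o) (mapIndex-unmapIndex (nestingIndex π) S r))

    depth-extendBy : ∀ m → depth (extendBy m) 0 ≡ depthAfter m
    depth-extendBy fixed           = depth-extend π false nothing (closesSemiᵇ⇒ClosesSemi nothing tt) 0
    depth-extendBy opening         = depth-extend π true nothing (closesSemiᵇ⇒ClosesSemi nothing tt) 0
    depth-extendBy (closing r o v) =
      trans (depth-extend π o _ (closesSemiᵇ⇒ClosesSemi _ (closesSemiᵇ-vertexOf (closing r o v))) 0)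
            (cong (λ z → depth π 0 ⊔ suc z) (sym (lookup-map-unmapIndex (nestingIndex π) S r)))

    inPiTilde-extendBy : InPiTilde k π → ∀ m → InPiTilde k (extendBy m)
    inPiTilde-extendBy ip m =
      admissible⇒inPiTilde (extendBy m)
        (subst₂ (Admissible k) (sym (depth-extendBy m)) (sym (profile-extendBy m)) (admissible-move m (inPiTilde⇒admissible π ip)))
      where
      admissible-move : ∀ m → Admissible k (depth π 0) (profile π) → Admissible k (depthAfter m) (afterMove m)
      admissible-move fixed           a = admissible-addFixed 2≤k a
      admissible-move opening         a = admissible-addSemi 2≤k a
      admissible-move (closing r o v) a = admissible-closeSemi (profile π) r o 2≤k a v

    module _ (o : Bool) (pos : Fin (length S)) where
      positionInProfile : Fin (length (profile π))
      positionInProfile = mapIndex (nestingIndex π) S pos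

      closing⁻ : InPiTilde k (extend π o (just (lookupL S pos))) → T (closable k (profile π) positionInProfile) × InPiTilde k π
      closing⁻ ip with admissible-closeSemi⁻ (profile π) positionInProfile o
                         (subst₂ (Admissible k) depth≡ (profile-closeSemi π o pos) (inPiTilde⇒admissible _ ip))
        where
        depth≡ : depth (extend π o (just (lookupL S pos))) 0 ≡ depth π 0 ⊔ suc (lookupL (profile π) positionInProfile)
        depth≡ = trans (depth-extend π o _ (closesSemiᵇ⇒ClosesSemi (just (lookupL S pos))
                          (≡true⇒T (All-lookup (finsWhere-sound (isSemiAt π)) pos))) 0)
                       (cong (λ z → depth π 0 ⊔ suc z) (sym (lookup-map-mapIndex (nestingIndex π) S pos)))
      ... | admissible , closable = closable , admissible⇒inPiTilde π admissible

    positionOf : ∀ s → T (isSemiAt π s) → Σ (Fin (length S)) (λ r → lookupL S r ≡ s)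
    positionOf s semi-s = finsWhere-complete (isSemiAt π) s (T⇒≡true semi-s)

    inPiTilde-closing : ∀ o s (semi-s : T (isSemiAt π s)) → InPiTilde k (extend π o (just s)) →
                        InPiTilde k (extend π o (just (lookupL S (proj₁ (positionOf s semi-s)))))
    inPiTilde-closing o s semi-s = subst (λ z → InPiTilde k (extend π o (just z))) (sym (proj₂ (positionOf s semi-s)))

    nonClosing : Bool → Move k (profile π)
    nonClosing false = fixed
    nonClosing true  = opening

    moveFrom : ∀ o c → T (closesSemiᵇ c) → .(InPiTilde k (extend π o c)) → Move k (profile π)
    moveFrom o     nothing  _      _  = nonClosing o
    moveFrom o     (just s) semi-s ip =
      closing (positionInProfile o pos) o (recompute (T? _) (proj₁ (closing⁻ o pos (inPiTilde-closing o s semi-s ip))))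
      where pos : Fin (length S)
            pos = proj₁ (positionOf s semi-s)

    inPiTilde-extend⁻ : ∀ o c → T (closesSemiᵇ c) → InPiTilde k (extend π o c) → InPiTilde k π
    inPiTilde-extend⁻ false nothing _ ip = admissible⇒inPiTilde π (admissible-addFixed⁻
      (subst₂ (Admissible k) (depth-extendBy fixed) (profile-extendBy fixed) (inPiTilde⇒admissible _ ip)))
    inPiTilde-extend⁻ true nothing _ ip = admissible⇒inPiTilde π (admissible-addSemi⁻
      (subst₂ (Admissible k) (depth-extendBy opening) (profile-extendBy opening) (inPiTilde⇒admissible _ ip)))
    inPiTilde-extend⁻ o (just s) semi-s ip = proj₂ (closing⁻ o (proj₁ (positionOf s semi-s)) (inPiTilde-closing o s semi-s ip))

    vertexOf-moveFrom : ∀ o c semi-c .ip → vertexOf (moveFrom o c semi-c ip) ≡ (o , c)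
    vertexOf-moveFrom false nothing  _      _  = refl
    vertexOf-moveFrom true  nothing  _      _  = refl
    vertexOf-moveFrom o     (just s) semi-s ip =
      cong (λ z → o , just z) (trans (cong (lookupL S) (unmapIndex-mapIndex (nestingIndex π) S (proj₁ (positionOf s semi-s))))
                                     (proj₂ (positionOf s semi-s)))

    moveFrom-vertexOf : ∀ m semi-c .ip → moveFrom (proj₁ (vertexOf m)) (proj₂ (vertexOf m)) semi-c ip ≡ m
    moveFrom-vertexOf fixed           _      _  = refl
    moveFrom-vertexOf opening         _      _  = refl
    moveFrom-vertexOf (closing r o v) semi-c ip = closing-cong o _ v (cong toℕ mapIndex-pos)
      where
      s : Fin n
      s = lookupL S (unmapIndex (nestingIndex π) S r)
      pos≡ : proj₁ (positionOf s semi-c) ≡ unmapIndex (nestingIndex π) S r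
      pos≡ = ascending-lookup-injective (finsWhere-ascending (isSemiAt π)) _ _ (proj₂ (positionOf s semi-c))
      mapIndex-pos : mapIndex (nestingIndex π) S (proj₁ (positionOf s semi-c)) ≡ r
      mapIndex-pos = trans (cong (mapIndex (nestingIndex π) S) pos≡) (mapIndex-unmapIndex (nestingIndex π) S r)

  moveFrom-subst : ∀ {n} {π₁ π₀ : Diagram n} (e : π₁ ≡ π₀) {o₁ o₀ c₁ c₀} → o₁ ≡ o₀ → c₁ ≡ c₀ →
                   (semi₁ : T (closesSemiᵇ π₁ c₁)) (semi₀ : T (closesSemiᵇ π₀ c₀)) →
                   .(ip₁ : InPiTilde k (extend π₁ o₁ c₁)) → .(ip₀ : InPiTilde k (extend π₀ o₀ c₀)) →
                   subst (λ π → Move k (profile π)) e (moveFrom π₁ o₁ c₁ semi₁ ip₁) ≡ moveFrom π₀ o₀ c₀ semi₀ ip₀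
  moveFrom-subst {π₁ = π} refl {o} {c₁ = c} refl refl semi₁ semi₀ ip₁ ip₀ =
    cong (λ z → moveFrom π o c z ip₀) (T-irrelevant semi₁ semi₀)

  PiTilde : ℕ → Set
  PiTilde n = Σ (Diagram n) (λ π → Irrelevant (InPiTilde k π))

  PiTildeMove : ℕ → Set
  PiTildeMove n = Σ (PiTilde n) (λ p → Move k (profile (proj₁ p)))

  closesSemiᵇ-lastCloses : ∀ {n} (π′ : Diagram (suc n)) → T (closesSemiᵇ (restrict π′) (lastCloses π′))
  closesSemiᵇ-lastCloses π′ with lastCloses π′ | closesSemi-lastCloses π′
  ... | nothing | _      = tt
  ... | just s  | closes = ≡true⇒T (cong isSemi (closes s refl))

  inPiTilde-extend-restrict : ∀ {n} (π′ : Diagram (suc n)) → InPiTilde k π′ →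
                              InPiTilde k (extend (restrict π′) (lastOpens π′) (lastCloses π′))
  inPiTilde-extend-restrict π′ = subst (InPiTilde k) (sym (extend-restrict π′))

  peelLast : ∀ {n} → PiTilde (suc n) → PiTildeMove n
  peelLast (π′ , [ ip′ ]) =
    (restrict π′ , [ inPiTilde-extend⁻ (restrict π′) (lastOpens π′) (lastCloses π′) (closesSemiᵇ-lastCloses π′)
                       (inPiTilde-extend-restrict π′ ip′) ]) ,
    moveFrom (restrict π′) (lastOpens π′) (lastCloses π′) (closesSemiᵇ-lastCloses π′) (inPiTilde-extend-restrict π′ ip′)

  appendMove : ∀ {n} → PiTildeMove n → PiTilde (suc n)
  appendMove ((π , [ ip ]) , m) = extendBy π m , [ inPiTilde-extendBy π ip m ]

  PiTilde-≡ : ∀ {n} {π₁ π₂ : Diagram n} (i₁ : Irrelevant (InPiTilde k π₁)) (i₂ : Irrelevant (InPiTilde k π₂)) →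
              π₁ ≡ π₂ → _≡_ {A = PiTilde n} (π₁ , i₁) (π₂ , i₂)
  PiTilde-≡ i₁ i₂ refl = refl

  PiTildeMove-≡ : ∀ {n} {π₁ π₀ : Diagram n} (i₁ : Irrelevant (InPiTilde k π₁)) (i₀ : Irrelevant (InPiTilde k π₀))
                  (m₁ : Move k (profile π₁)) (m₀ : Move k (profile π₀)) (e : π₁ ≡ π₀) →
                  subst (λ π → Move k (profile π)) e m₁ ≡ m₀ → _≡_ {A = PiTildeMove n} ((π₁ , i₁) , m₁) ((π₀ , i₀) , m₀)
  PiTildeMove-≡ i₁ i₀ m₁ m₀ refl refl = refl

  appendMove-peelLast : ∀ {n} (p : PiTilde (suc n)) → appendMove (peelLast p) ≡ p
  appendMove-peelLast (π′ , [ ip′ ]) = PiTilde-≡ _ _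
    (trans (cong (λ z → extend (restrict π′) (proj₁ z) (proj₂ z))
                 (vertexOf-moveFrom (restrict π′) (lastOpens π′) (lastCloses π′) (closesSemiᵇ-lastCloses π′) _))
           (extend-restrict π′))

  peelLast-appendMove : ∀ {n} (q : PiTildeMove n) → peelLast (appendMove q) ≡ q
  peelLast-appendMove ((π , [ ip ]) , m) = PiTildeMove-≡ _ _ _ _ restrict≡
    (trans (moveFrom-subst restrict≡ (lastOpens-extend π o c) (lastCloses-extend π o c)
              (closesSemiᵇ-lastCloses (extendBy π m)) (closesSemiᵇ-vertexOf π m) _ (inPiTilde-extendBy π ip m))
           (moveFrom-vertexOf π m (closesSemiᵇ-vertexOf π m) (inPiTilde-extendBy π ip m)))
    where
    o : Bool
    o = proj₁ (vertexOf π m)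
    c : Maybe (Fin _)
    c = proj₂ (vertexOf π m)
    restrict≡ : restrict (extendBy π m) ≡ π
    restrict≡ = restrict-extend π o c (closesSemiᵇ⇒ClosesSemi π c (closesSemiᵇ-vertexOf π m))

  profile<k : ∀ {n} (p : PiTilde n) → All (_< k) (profile (proj₁ p))
  profile<k (π , [ ip ]) = recompute (all? (_<? k) (profile π)) (proj₂ (inPiTilde⇒admissible π ip))

  emptyDiagram : Diagram 0
  emptyDiagram = diagram [] (record { leftLess = λ () ; rightOnce = λ () })

  enum-PiTilde : ∀ n → Enum {A = PiTilde n} (λ p → label k (profile (proj₁ p))) (level n)
  enum-PiTilde zero = record
    { to      = λ _ → zero
    ; from    = λ _ → emptyDiagram , [ admissible⇒inPiTilde emptyDiagram (z≤n , []) ]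
    ; from-to = λ { (diagram [] _ , _) → refl }
    ; to-from = λ { zero → refl }
    ; compat  = λ { zero → label-[] k } }
  enum-PiTilde (suc n) =
    enum-subst (sym (descendants-suc n (rootLabel k ∷ [])))
      (enum-relabel label-peelLast (enum-transport peelLast appendMove peelLast-appendMove appendMove-peelLast enum-PiTildeMove))
    where
    enum-PiTildeMove : Enum {A = PiTildeMove n} (λ q → label k (afterMove (proj₂ q))) (concat (map (Rules.children k) (level n)))
    enum-PiTildeMove = enum-Σ (Rules.children k) (enum-PiTilde n)
      (λ p → MoveEnumeration.enum-moves k 2≤k (profile (proj₁ p)) (profile-decreasing (proj₁ p)) (profile<k p))
    label-peelLast : ∀ p → label k (afterMove (proj₂ (peelLast p))) ≡ label k (profile (proj₁ p))
    label-peelLast p = cong (label k) (trans (sym (profile-extendBy (proj₁ (proj₁ (peelLast p))) (proj₂ (peelLast p))))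
                                             (cong (λ z → profile (proj₁ z)) (appendMove-peelLast p)))


open Enumeration using (enum⇒↔)

theorem7 : (k : ℕ) → 2 ≤ k → (n : ℕ) →
    Σ (Diagram n) (λ π → Irrelevant (InPiTilde k π)) ↔ Fin (nodesAtLevel k n (rootLabel k))
theorem7 k 2≤k n rewrite TreeLevels.nodesAtLevel≡length-level k n = enum⇒↔ (Decomposition.enum-PiTilde k 2≤k n)
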